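{- Let $p\equiv 3\pmod 4$ be a prime, $R\ge 2$ an even integer, $h\ge1$ an odd integer with $2h\mid(p-1)$, $V=\mathbb{F}_{p^R}$, $\omega$ a primitive element of $V$, $S_0=\{\omega^{4hj}:j\ge0\}$, and let $\Gamma=\mathrm{TGPaley}(p^R,\frac{p^R-1}{2h})=\mathrm{Cay}(V,S_0\cup\omega^{3h}S_0)$. Let $G=T\rtimes\langle\widehat{\omega}^2,\widehat{\omega}\alpha\rangle$ and $M=T\rtimes\langle\widehat{\omega}^{4h},\widehat{\omega}^h\alpha\rangle$. Then: (1) $\Gamma$ is an undirected $M$-arc-transitive graph of valency $\frac{p^R-1}{2h}$. (2) With $\mathcal{E}_{TGP}(p^R,2h)=\{E_1,\dots,E_{2h}\}$, where $E_i=\{\{u,v\}: v-u\in\omega^{2(i-1)}(S_0\cup\omega^{3h}S_0)\}$, the 4-tuple $(M,G,V,\mathcal{E}_{TGP}(p^R,2h))$ is a homogeneous factorisation of $K_{p^R}=(V,E)$ of index $2h$ in which $M$ is arc-transitive on each factor; moreover each factor $\Gamma_i=(V,E_i)$ is isomorphic to $\Gamma$.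
   Context: $\mathrm{Cay}(V,S)$ has vertex set $V$ and edges $\{u,v\}$ with $v-u\in S$. $T$ is the group of translations of $V$, $\widehat{\omega}$ is the map $x\mapsto x\omega$ and $\alpha$ the Frobenius map $x\mapsto x^p$; maps act on the right, so $\widehat{\omega}^h\alpha$ means first $\widehat{\omega}^h$ then $\alpha$. A homogeneous factorisation of index $k>1$ of $K_n=(V,E)$ is a 4-tuple $(M,G,V,\mathcal{E})$ where $\mathcal{E}$ partitions the set $E$ of 2-subsets of $V$ into $k$ parts, $G\le\mathrm{Sym}(V)$ is transitive on $V$, leaves $\mathcal{E}$ invariant and permutes its parts transitively, and the kernel $M$ of this action is transitive on $V$; factors are $(V,E_i)$. -}

module Defs where

open import Data.Nat as ℕ using (ℕ; zero; suc; _∸_; _≤_; NonZero; >-nonZero)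
open import Data.Nat.Properties using (≤-trans; m≤m+n)
open import Data.Nat.DivMod using (_/_)
open import Data.Fin using (Fin; toℕ)
open import Data.List using (List; foldl)
open import Data.Product using (Σ; ∃; ∃-syntax; _×_; _,_)
open import Data.Sum using (_⊎_)
open import Function using (_∘_; Injective; Bijective)
open import Relation.Binary.PropositionalEquality using (_≡_)
open import Relation.Nullary using (¬_)
import Algebra.Structures

-- Fields (agda-stdlib 2.3 has no Field bundle).  Equality is _≡_:
-- a finite field can always be presented with propositional equality.

record Field : Set₁ where
  infixl 6 _+_
  infixl 7 _*_
  field
    Carrier : Set
    _+_ _*_ : Carrier → Carrier → Carrier
    -_      : Carrier → Carrier
    0# 1#   : Carrier
    isCommutativeRing :
      Algebra.Structures.IsCommutativeRing {A = Carrier} _≡_ _+_ _*_ -_ 0# 1#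
    0≢1     : ¬ (0# ≡ 1#)
    inverse : ∀ x → ¬ (x ≡ 0#) → ∃[ y ] (x * y ≡ 1#)

  infixl 6 _-_
  _-_ : Carrier → Carrier → Carrier
  x - y = x + (- y)

  infixr 8 _^_
  _^_ : Carrier → ℕ → Carrier
  x ^ zero  = 1#
  x ^ suc n = x * (x ^ n)

_⟺_ : Set → Set → Set
A ⟺ B = (A → B) × (B → A)

HasSize : {V : Set} → (V → Set) → ℕ → Set
HasSize {V} P n =
  Σ (Fin n → V) λ f → (∀ k → P (f k)) × Injective _≡_ _≡_ f
                      × (∀ x → P x → ∃[ k ] (f k ≡ x))

-- maps act on the right: a word [g₁, g₂, …] means first g₁, then g₂, …
run : {V A : Set} → (A → V → V) → List A → V → V
run act w x = foldl (λ y g → act g y) x w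

-- f lies in the permutation group generated by the maps act a (a : A).
-- (Since V is finite, the monoid generated by permutations is the group.)
Generated : {V A : Set} → (A → V → V) → (V → V) → Set
Generated {V} {A} act f = ∃[ w ] (∀ x → f x ≡ run act w x)

Undirected : {V : Set} → (V → V → Set) → Set
Undirected Adj = ∀ u v → Adj u v → Adj v u

ArcTransitive : {V : Set} → ((V → V) → Set) → (V → V → Set) → Set
ArcTransitive {V} InX Adj =
  (∀ u v → ∃[ g ] (InX g × g u ≡ v)) ×
  (∀ u v u' v' → Adj u v → Adj u' v' → ∃[ g ] (InX g × g u ≡ u' × g v ≡ v'))

Isomorphic : {V : Set} → (V → V → Set) → (V → V → Set) → Set
Isomorphic {V} A B =
  Σ (V → V) λ φ → Bijective _≡_ _≡_ φ × (∀ u v → A u v ⟺ B (φ u) (φ v))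

-- Homogeneous factorisation (M,G,V,𝓔) of index k of K_V.
-- 𝓔 = {E i : i : Fin k}; a 2-subset {u,v} ∈ E i is encoded by the
-- symmetric, irreflexive relation E i u v.
record HomogeneousFactorisation {V : Set} (InM InG : (V → V) → Set)
         (k : ℕ) (E : Fin k → V → V → Set) : Set where
  field
    index>1      : 2 ≤ k
    irreflexive  : ∀ i u v → E i u v → ¬ (u ≡ v)
    symmetric    : ∀ i u v → E i u v → E i v u
    nonempty     : ∀ i → ∃[ u ] ∃[ v ] E i u v
    cover-unique : ∀ u v → ¬ (u ≡ v) →
                   ∃[ i ] (E i u v × (∀ j → E j u v → j ≡ i))
    G-perm       : ∀ g → InG g → Bijective _≡_ _≡_ g
    G-transitive : ∀ u v → ∃[ g ] (InG g × g u ≡ v)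
    G-invariant  : ∀ g → InG g → ∀ i →
                   ∃[ j ] (∀ u v → E i u v ⟺ E j (g u) (g v))
    G-parts-transitive : ∀ i j →
                   ∃[ g ] (InG g × (∀ u v → E i u v ⟺ E j (g u) (g v)))
    M-kernel     : ∀ g → InM g ⟺
                   (InG g × (∀ i u v → E i u v ⟺ E i (g u) (g v)))
    M-transitive : ∀ u v → ∃[ m ] (InM m × m u ≡ v)

module TGP (F : Field) (p h : ℕ) (ω : Field.Carrier F) where
  open Field F

  S₀ : Carrier → Set
  S₀ x = ∃[ j ] (x ≡ ω ^ (4 ℕ.* h ℕ.* j))

  S : Carrier → Set
  S x = S₀ x ⊎ ∃[ y ] (S₀ y × x ≡ ω ^ (3 ℕ.* h) * y)

  Γ : Carrier → Carrier → Set
  Γ u v = S (v - u)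

  -- E_i = {{u,v} : v - u ∈ ω^(2(i-1)) S}, i = 1..2h  (here i ∈ Fin 2h, 0-based)
  E : Fin (2 ℕ.* h) → Carrier → Carrier → Set
  E i u v = ∃[ y ] (S y × v - u ≡ ω ^ (2 ℕ.* toℕ i) * y)

  τ : Carrier → Carrier → Carrier
  τ c x = x + c

  hat : Carrier → Carrier → Carrier
  hat a x = x * a

  α : Carrier → Carrier
  α x = x ^ p

  data GenG : Set where
    transl : Carrier → GenG
    ω̂²     : GenG
    ω̂α     : GenG

  actG : GenG → Carrier → Carrier
  actG (transl c) = τ c
  actG ω̂²         = hat (ω ^ 2)
  actG ω̂α         = α ∘ hat ω

  data GenM : Set where
    transl : Carrier → GenM
    ω̂⁴ʰ    : GenM
    ω̂ʰα    : GenM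

  actM : GenM → Carrier → Carrier
  actM (transl c) = τ c
  actM ω̂⁴ʰ        = hat (ω ^ (4 ℕ.* h))
  actM ω̂ʰα        = α ∘ hat (ω ^ h)

  InG : (Carrier → Carrier) → Set
  InG = Generated actG

  InM : (Carrier → Carrier) → Set
  InM = Generated actM

valency : (p R h : ℕ) → 1 ≤ h → ℕ
valency p R h h≥1 =
  ((p ℕ.^ R ∸ 1) / (2 ℕ.* h)) {{ >-nonZero (≤-trans h≥1 (m≤m+n h _)) }}

-- Write every nonzero element as a power ω^a with a taken modulo q - 1, where
-- q = p^R.  Then ω^(2i) S consists of the ω^a with a ≡ 2i or a ≡ 2i + 3h
-- (mod 4h).  As p ≡ 3 (mod 4) and h is odd, p ≡ 1 + 2h (mod 4h), so
-- multiplying an exponent by p fixes the even residues and adds 2h to the odd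
-- ones: x ↦ (x ω^h)^p swaps the two residues of every part, ω̂^(4h) fixes
-- them, and ω̂² moves part i to part i + 1.  Hence M fixes every part and G
-- permutes the parts transitively.  Every element of G has the form
-- x ↦ x^(p^j) ω^e + c; if it fixes all parts, the images of 1 and ω^(3h)
-- force e to be congruent modulo 4h to the exponent of (ω̂^h α)^j, so the
-- element lies in M.  Finally 8h ∣ q - 1 because R is even, so
-- -1 = ω^((q-1)/2) is a power of ω^(4h) and all the graphs are undirected.

module Submission where

open import Defs
open import Data.Nat using (ℕ; _*_; _^_; _∸_; _%_; _≤_)
open import Data.Nat.Divisibility using (_∣_)
open import Data.Nat.Primality using (Prime)
open import Data.Fin using (Fin)
open import Data.Product using (∃-syntax; _×_)
open import Function.Bundles using (_↔_)
open import Relation.Binary.PropositionalEquality using (_≡_)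
open import Relation.Nullary using (¬_)

open import Data.Nat using (zero; suc; pred; _+_; _<_; NonZero; >-nonZero; ≢-nonZero; z≤n; s≤s)
open import Data.Nat.Base using (_!; nonTrivial⇒n>1)
import Data.Nat.Properties as ℕ
open import Data.Nat.DivMod using (_/_; m/n*n≡m; m*n/n≡m; m%n<n; m≡m%n+[m/n]*n; m<n⇒m%n≡m; [m+kn]%n≡m%n)
open import Data.Nat.Divisibility using (divides; ∣⇒≤; ∣1⇒≡1; m∣m*n)
open import Data.Nat.Primality using (euclidsLemma; prime⇒nonTrivial; prime⇒nonZero)
open import Data.Nat.Combinatorics using (_C_; nCk≡n!/k![n-k]!; k![n∸k]!∣n!; nCn≡1)
open import Data.Nat.Tactic.RingSolver using (solve-∀)
import Data.Fin as Fin
import Data.Fin.Properties as Fin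
open import Data.Fin.Properties using (*↔×)
import Data.Fin.Permutation as Permutation
open import Data.List using (List; []; _∷_; _++_; replicate)
open import Data.List.Properties using (foldl-++)
open import Data.Product using (∃; ∃₂; _,_; proj₁; proj₂; map₁; map₂; uncurry)
open import Data.Sum using (_⊎_; inj₁; inj₂; [_,_]′)
open import Data.Empty using (⊥-elim)
open import Function using (_∘_; id; Injective; Bijective)
open import Function.Bundles using (Inverse; mk↔ₛ′)
open import Function.Properties.Inverse using (↔-sym; ↔-trans)
open import Level using (0ℓ)
open import Relation.Nullary using (Dec; yes; no)
open import Relation.Unary using (Decidable)
open import Relation.Binary.Bundles using (Setoid)
open import Relation.Binary.Structures using (IsEquivalence)
open import Relation.Binary.PropositionalEquality
  using (refl; sym; trans; cong; cong₂; subst; subst₂; _≢_; module ≡-Reasoning)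
import Relation.Binary.Reasoning.Setoid
open import Algebra.Bundles using (CommutativeRing)
open import Algebra.Structures using (IsCommutativeRing)
import Algebra.Definitions.RawMonoid
import Algebra.Properties.Ring
import Algebra.Properties.Monoid.Mult
import Algebra.Properties.Semiring.Mult
import Algebra.Properties.Semiring.Exp
import Algebra.Properties.CommutativeSemiring.Exp
import Algebra.Properties.CommutativeSemiring.Binomial
import Algebra.Properties.CommutativeMonoid.Sum

-- Congruence of natural numbers

infix 4 _≡_mod_
_≡_mod_ : ℕ → ℕ → ℕ → Set
_≡_mod_ a b m = ∃₂ λ x y → a + x * m ≡ b + y * m

module _ {m : ℕ} where

  mod-reflexive : ∀ {a b} → a ≡ b → a ≡ b mod m
  mod-reflexive refl = 0 , 0 , refl

  mod-refl : ∀ {a} → a ≡ a mod m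
  mod-refl = mod-reflexive refl

  mod-sym : ∀ {a b} → a ≡ b mod m → b ≡ a mod m
  mod-sym (x , y , e) = y , x , sym e

  mod-trans : ∀ {a b c} → a ≡ b mod m → b ≡ c mod m → a ≡ c mod m
  mod-trans {a} {b} {c} (x , y , a≡b) (x′ , y′ , b≡c) = x + x′ , y′ + y , (begin
    a + (x + x′) * m         ≡⟨ shuffle a x x′ m ⟩
    (a + x * m) + x′ * m     ≡⟨ cong (_+ x′ * m) a≡b ⟩
    (b + y * m) + x′ * m     ≡⟨ swap b y x′ m ⟩
    (b + x′ * m) + y * m     ≡⟨ cong (_+ y * m) b≡c ⟩
    (c + y′ * m) + y * m     ≡⟨ shuffle c y′ y m ⟨
    c + (y′ + y) * m         ∎)
    where
    open ≡-Reasoning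
    shuffle : ∀ a x x′ m → a + (x + x′) * m ≡ (a + x * m) + x′ * m
    shuffle = solve-∀
    swap : ∀ b y x′ m → (b + y * m) + x′ * m ≡ (b + x′ * m) + y * m
    swap = solve-∀

  +-mod-cong : ∀ {a b c d} → a ≡ b mod m → c ≡ d mod m → a + c ≡ b + d mod m
  +-mod-cong {a} {b} {c} {d} (x , y , a≡b) (x′ , y′ , c≡d) = x + x′ , y + y′ , (begin
    (a + c) + (x + x′) * m       ≡⟨ interchange a c x x′ m ⟩
    (a + x * m) + (c + x′ * m)   ≡⟨ cong₂ _+_ a≡b c≡d ⟩
    (b + y * m) + (d + y′ * m)   ≡⟨ interchange b d y y′ m ⟨
    (b + d) + (y + y′) * m       ∎)
    where
    open ≡-Reasoning
    interchange : ∀ a c x x′ m → (a + c) + (x + x′) * m ≡ (a + x * m) + (c + x′ * m)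
    interchange = solve-∀

  +-mod-congˡ : ∀ c {a b} → a ≡ b mod m → c + a ≡ c + b mod m
  +-mod-congˡ c = +-mod-cong (mod-refl {c})

  +-mod-congʳ : ∀ c {a b} → a ≡ b mod m → a + c ≡ b + c mod m
  +-mod-congʳ c a≡b = +-mod-cong a≡b (mod-refl {c})

  *-mod-congˡ : ∀ c {a b} → a ≡ b mod m → c * a ≡ c * b mod m
  *-mod-congˡ c {a} {b} (x , y , a≡b) = c * x , c * y , (begin
    c * a + c * x * m    ≡⟨ factor c a x m ⟩
    c * (a + x * m)      ≡⟨ cong (c *_) a≡b ⟩
    c * (b + y * m)      ≡⟨ factor c b y m ⟨
    c * b + c * y * m    ∎)
    where
    open ≡-Reasoning
    factor : ∀ c a x m → c * a + c * x * m ≡ c * (a + x * m)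
    factor = solve-∀

  *-mod-congʳ : ∀ c {a b} → a ≡ b mod m → a * c ≡ b * c mod m
  *-mod-congʳ c {a} {b} a≡b rewrite ℕ.*-comm a c | ℕ.*-comm b c = *-mod-congˡ c a≡b

  +-mod-cancelˡ : ∀ c {a b} → c + a ≡ c + b mod m → a ≡ b mod m
  +-mod-cancelˡ c {a} {b} (x , y , e) =
    x , y , ℕ.+-cancelˡ-≡ c _ _ (trans (sym (ℕ.+-assoc c a _)) (trans e (ℕ.+-assoc c b _)))

  +-mod-cancelʳ : ∀ c {a b} → a + c ≡ b + c mod m → a ≡ b mod m
  +-mod-cancelʳ c {a} {b} rewrite ℕ.+-comm a c | ℕ.+-comm b c = +-mod-cancelˡ c

  +*-mod : ∀ a k → a + k * m ≡ a mod m
  +*-mod a k = 0 , k , ℕ.+-identityʳ _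

  +*-mod′ : ∀ a k → a + m * k ≡ a mod m
  +*-mod′ a k = subst (λ x → a + x ≡ a mod m) (ℕ.*-comm k m) (+*-mod a k)

  +-mod-modulus : ∀ a → a + m ≡ a mod m
  +-mod-modulus a = subst (λ x → a + x ≡ a mod m) (ℕ.*-identityˡ m) (+*-mod a 1)

  %-mod : ∀ a .{{_ : NonZero m}} → a ≡ a % m mod m
  %-mod a = 0 , a / m , trans (ℕ.+-identityʳ a) (m≡m%n+[m/n]*n a m)

  mod-<⇒≡ : ∀ {a b} → a < m → b < m → a ≡ b mod m → a ≡ b
  mod-<⇒≡ {a} {b} a<m b<m (x , y , e) = begin
    a                  ≡⟨ m<n⇒m%n≡m a<m ⟨
    a % m              ≡⟨ [m+kn]%n≡m%n a x m ⟨
    (a + x * m) % m    ≡⟨ cong (_% m) e ⟩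
    (b + y * m) % m    ≡⟨ [m+kn]%n≡m%n b y m ⟩
    b % m              ≡⟨ m<n⇒m%n≡m b<m ⟩
    b                  ∎
    where
    open ≡-Reasoning
    instance _ : NonZero m
             _ = >-nonZero (ℕ.≤-<-trans z≤n a<m)

  mod-isEquivalence : IsEquivalence (λ a b → a ≡ b mod m)
  mod-isEquivalence = record { refl = mod-refl ; sym = mod-sym ; trans = mod-trans }

mod-setoid : ℕ → Setoid _ _
mod-setoid m = record { isEquivalence = mod-isEquivalence {m} }

module ≡-mod-Reasoning (m : ℕ) = Relation.Binary.Reasoning.Setoid (mod-setoid m)

mod-divisor : ∀ {m a b} k → a ≡ b mod m * k → a ≡ b mod m
mod-divisor {m} {a} {b} k (x , y , e) =
  x * k , y * k , trans (cong (a +_) (reassoc x k m)) (trans e (cong (b +_) (sym (reassoc y k m))))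
  where
  reassoc : ∀ x k m → x * k * m ≡ x * (m * k)
  reassoc = solve-∀

even≢odd-mod : ∀ k {a b} → ¬ (2 * a ≡ 1 + 2 * b mod (2 * k))
even≢odd-mod k {a} {b} 2a≡1+2b with mod-divisor {2} k 2a≡1+2b
... | x , y , eq = 0≢1 (begin
  0                        ≡⟨ [m+kn]%n≡m%n 0 (a + x) 2 ⟨
  (0 + (a + x) * 2) % 2    ≡⟨ cong (_% 2) (trans (evenForm a x) (trans eq (oddForm b y))) ⟩
  (1 + (b + y) * 2) % 2    ≡⟨ [m+kn]%n≡m%n 1 (b + y) 2 ⟩
  1                        ∎)
  where
  open ≡-Reasoning
  0≢1 : 0 ≢ 1
  0≢1 ()
  evenForm : ∀ a x → 0 + (a + x) * 2 ≡ 2 * a + x * 2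
  evenForm = solve-∀
  oddForm : ∀ b y → 1 + 2 * b + y * 2 ≡ 1 + (b + y) * 2
  oddForm = solve-∀


HasSize-via : ∀ {V A : Set} {P : V → Set} {n} → Fin n ↔ A → (f : A → V) → (∀ a → P (f a)) →
              Injective _≡_ _≡_ f → (∀ x → P x → ∃[ a ] (f a ≡ x)) → HasSize P n
HasSize-via {n = n} enum f f∈P f-injective f-onto =
  f ∘ to , f∈P ∘ to , to-injective ∘ f-injective ,
  λ x Px → from (proj₁ (f-onto x Px)) , trans (cong f (strictlyInverseˡ _)) (proj₂ (f-onto x Px))
  where
  open Inverse enum using (to; from; strictlyInverseˡ; strictlyInverseʳ)
  to-injective : Injective _≡_ _≡_ to
  to-injective {i} {j} eq = trans (sym (strictlyInverseʳ i)) (trans (cong from eq) (strictlyInverseʳ j))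

-- Elementary number theory

LeastPositive : (ℕ → Set) → ℕ → Set
LeastPositive P n = 1 ≤ n × P n × (∀ j → 1 ≤ j → j < n → ¬ P j)

module _ {P : ℕ → Set} (P? : Decidable P) where

  private
    search : ∀ n → ∃ (LeastPositive P) ⊎ (∀ j → 1 ≤ j → j ≤ n → ¬ P j)
    search zero = inj₂ λ j 1≤j j≤0 _ → ℕ.<⇒≱ 1≤j j≤0
    search (suc n) with search n
    ... | inj₁ least = inj₁ least
    ... | inj₂ none with P? (suc n)
    ...   | yes Pn = inj₁ (suc n , s≤s z≤n , Pn , λ j 1≤j j≤n → none j 1≤j (ℕ.≤-pred j≤n))
    ...   | no ¬Pn = inj₂ λ j 1≤j j≤1+n → [ (λ j≤n → none j 1≤j (ℕ.≤-pred j≤n)) , (λ { refl → ¬Pn }) ]′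
                                          (ℕ.m≤n⇒m<n∨m≡n j≤1+n)

  leastPositive : ∀ {n} → 1 ≤ n → P n → ∃ (LeastPositive P)
  leastPositive {n} 1≤n Pn with search n
  ... | inj₁ least = least
  ... | inj₂ none  = ⊥-elim (none n 1≤n ℕ.≤-refl Pn)

1+multiple-^ : ∀ m c r → ∃[ d ] ((1 + m * c) ^ r ≡ 1 + m * d)
1+multiple-^ m c zero    = 0 , cong suc (sym (ℕ.*-zeroʳ m))
1+multiple-^ m c (suc r) with 1+multiple-^ m c r
... | d , eq = c + (1 + m * c) * d , trans (cong ((1 + m * c) *_) eq) (expand m c d)
  where
  expand : ∀ m c d → (1 + m * c) * (1 + m * d) ≡ 1 + m * (c + (1 + m * c) * d)
  expand = solve-∀

nCk*k!*[n∸k]!≡n! : ∀ {n k} → k ≤ n → (n C k) * (k ! * (n ∸ k) !) ≡ n !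
nCk*k!*[n∸k]!≡n! {n} {k} k≤n =
  trans (cong (_* (k ! * (n ∸ k) !)) (nCk≡n!/k![n-k]! k≤n)) (m/n*n≡m (k![n∸k]!∣n! k≤n))
  where instance _ : NonZero (k ! * (n ∸ k) !)
                 _ = k ℕ.!* (n ∸ k) !≢0

n∣n! : ∀ n .{{_ : NonZero n}} → n ∣ n !
n∣n! (suc n) = m∣m*n (n !)

module _ {p : ℕ} (isPrime : Prime p) where

  prime∤! : ∀ {m} → m < p → ¬ p ∣ m !
  prime∤! {zero}  _   p∣1 = ℕ.<⇒≢ (nonTrivial⇒n>1 p {{prime⇒nonTrivial isPrime}}) (sym (∣1⇒≡1 p∣1))
  prime∤! {suc m} m<p p∣m! with euclidsLemma (suc m) (m !) isPrime p∣m!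
  ... | inj₁ p∣1+m = ℕ.<⇒≱ m<p (∣⇒≤ p∣1+m)
  ... | inj₂ p∣m!  = prime∤! (ℕ.<-trans (ℕ.n<1+n m) m<p) p∣m!

  prime∣pCk : ∀ {k} → 1 ≤ k → k < p → p ∣ (p C k)
  prime∣pCk {k} 1≤k k<p
    with euclidsLemma (p C k) _ isPrime
           (subst (p ∣_) (sym (nCk*k!*[n∸k]!≡n! (ℕ.<⇒≤ k<p))) (n∣n! p {{prime⇒nonZero isPrime}}))
  ... | inj₁ p∣pCk = p∣pCk
  ... | inj₂ p∣k!*[p∸k]! with euclidsLemma (k !) _ isPrime p∣k!*[p∸k]!
  ...   | inj₁ p∣k!     = ⊥-elim (prime∤! k<p p∣k!)
  ...   | inj₂ p∣[p∸k]! = ⊥-elim (prime∤! (ℕ.∸-monoʳ-< {p} {k} {0} 1≤k (ℕ.<⇒≤ k<p)) p∣[p∸k]!)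

-- Fields

module FieldProperties (F : Field) where

  open Field F public using (Carrier; 0#; 1#; -_; _-_; 0≢1; inverse)
    renaming (_+_ to _⊕_; _*_ to _·_; _^_ to _^ᶠ_)
  open IsCommutativeRing (Field.isCommutativeRing F) public
    using (+-assoc; +-comm; +-identityˡ; +-identityʳ; -‿inverseˡ; -‿inverseʳ;
           *-assoc; *-comm; *-identityˡ; *-identityʳ; distribˡ; distribʳ; zeroˡ)

  commutativeRing : CommutativeRing 0ℓ 0ℓ
  commutativeRing = record { isCommutativeRing = Field.isCommutativeRing F }

  open CommutativeRing commutativeRing public
    using (ring; semiring; commutativeSemiring; +-commutativeMonoid; +-rawMonoid; +-monoid)
  open Algebra.Properties.Ring ring public
    using (-‿distribˡ-*; -0#≈0#; -‿anti-homo-+; ⁻¹-anti-homo‿-; x∙y⁻¹≈ε⇒x≈y)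
  open Algebra.Properties.Semiring.Exp semiring using (^-homo-*; ^-assocʳ)
    renaming (_^_ to _^ˢ_)
  open Algebra.Properties.CommutativeSemiring.Exp commutativeSemiring using (^-distrib-*)
  open Algebra.Definitions.RawMonoid +-rawMonoid public using () renaming (_×_ to _⨯_)
  open ≡-Reasoning

  ^ᶠ≡^ˢ : ∀ x n → x ^ᶠ n ≡ x ^ˢ n
  ^ᶠ≡^ˢ x zero    = refl
  ^ᶠ≡^ˢ x (suc n) = cong (x ·_) (^ᶠ≡^ˢ x n)

  ^-+ : ∀ x a b → x ^ᶠ (a + b) ≡ x ^ᶠ a · x ^ᶠ b
  ^-+ x a b = begin
    x ^ᶠ (a + b)      ≡⟨ ^ᶠ≡^ˢ x (a + b) ⟩
    x ^ˢ (a + b)      ≡⟨ ^-homo-* x a b ⟩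
    x ^ˢ a · x ^ˢ b   ≡⟨ cong₂ _·_ (^ᶠ≡^ˢ x a) (^ᶠ≡^ˢ x b) ⟨
    x ^ᶠ a · x ^ᶠ b   ∎

  ^-* : ∀ x a b → x ^ᶠ (a * b) ≡ (x ^ᶠ a) ^ᶠ b
  ^-* x a b = begin
    x ^ᶠ (a * b)      ≡⟨ ^ᶠ≡^ˢ x (a * b) ⟩
    x ^ˢ (a * b)      ≡⟨ ^-assocʳ x a b ⟨
    (x ^ˢ a) ^ˢ b     ≡⟨ ^ᶠ≡^ˢ (x ^ˢ a) b ⟨
    (x ^ˢ a) ^ᶠ b     ≡⟨ cong (_^ᶠ b) (^ᶠ≡^ˢ x a) ⟨
    (x ^ᶠ a) ^ᶠ b     ∎

  *-^ : ∀ x y n → (x · y) ^ᶠ n ≡ x ^ᶠ n · y ^ᶠ n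
  *-^ x y n = begin
    (x · y) ^ᶠ n      ≡⟨ ^ᶠ≡^ˢ (x · y) n ⟩
    (x · y) ^ˢ n      ≡⟨ ^-distrib-* x y n ⟩
    x ^ˢ n · y ^ˢ n   ≡⟨ cong₂ _·_ (^ᶠ≡^ˢ x n) (^ᶠ≡^ˢ y n) ⟨
    x ^ᶠ n · y ^ᶠ n   ∎

  *-cancelʳ : ∀ {x} a b → x ≢ 0# → a · x ≡ b · x → a ≡ b
  *-cancelʳ {x} a b x≢0 ax≡bx with inverse x x≢0
  ... | x⁻¹ , xx⁻¹≡1 = begin
    a                ≡⟨ *-identityʳ a ⟨
    a · 1#           ≡⟨ cong (a ·_) xx⁻¹≡1 ⟨
    a · (x · x⁻¹)    ≡⟨ *-assoc a x x⁻¹ ⟨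
    (a · x) · x⁻¹    ≡⟨ cong (_· x⁻¹) ax≡bx ⟩
    (b · x) · x⁻¹    ≡⟨ *-assoc b x x⁻¹ ⟩
    b · (x · x⁻¹)    ≡⟨ cong (b ·_) xx⁻¹≡1 ⟩
    b · 1#           ≡⟨ *-identityʳ b ⟩
    b                ∎

  *-≢0 : ∀ {x y} → x ≢ 0# → y ≢ 0# → x · y ≢ 0#
  *-≢0 {x} {y} x≢0 y≢0 xy≡0 = y≢0 (*-cancelʳ y 0# x≢0 (begin
    y · x   ≡⟨ *-comm y x ⟩
    x · y   ≡⟨ xy≡0 ⟩
    0#      ≡⟨ zeroˡ x ⟨
    0# · x  ∎))

  ^-≢0 : ∀ {x} n → x ≢ 0# → x ^ᶠ n ≢ 0#
  ^-≢0 zero    x≢0 1≡0 = 0≢1 (sym 1≡0)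
  ^-≢0 (suc n) x≢0     = *-≢0 x≢0 (^-≢0 n x≢0)

  0^ : ∀ n .{{_ : NonZero n}} → 0# ^ᶠ n ≡ 0#
  0^ (suc n) = zeroˡ _

  x-0≡x : ∀ x → x - 0# ≡ x
  x-0≡x x = trans (cong (x ⊕_) -0#≈0#) (+-identityʳ x)

  x-y+y≡x : ∀ x y → (x - y) ⊕ y ≡ x
  x-y+y≡x x y = begin
    (x ⊕ - y) ⊕ y    ≡⟨ +-assoc x (- y) y ⟩
    x ⊕ (- y ⊕ y)    ≡⟨ cong (x ⊕_) (-‿inverseˡ y) ⟩
    x ⊕ 0#           ≡⟨ +-identityʳ x ⟩
    x                ∎

  x+y-y≡x : ∀ x y → (x ⊕ y) - y ≡ x
  x+y-y≡x x y = begin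
    (x ⊕ y) ⊕ - y    ≡⟨ +-assoc x y (- y) ⟩
    x ⊕ (y ⊕ - y)    ≡⟨ cong (x ⊕_) (-‿inverseʳ y) ⟩
    x ⊕ 0#           ≡⟨ +-identityʳ x ⟩
    x                ∎

  x+[y-x]≡y : ∀ x y → x ⊕ (y - x) ≡ y
  x+[y-x]≡y x y = trans (+-comm x (y - x)) (x-y+y≡x y x)

  [x+y]-x≡y : ∀ x y → (x ⊕ y) - x ≡ y
  [x+y]-x≡y x y = trans (cong (_- x) (+-comm x y)) (x+y-y≡x y x)

  x-y≡0⇒x≡y : ∀ {x y} → x - y ≡ 0# → x ≡ y
  x-y≡0⇒x≡y = x∙y⁻¹≈ε⇒x≈y _ _

  -[y-x]≡x-y : ∀ x y → - (y - x) ≡ x - y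
  -[y-x]≡x-y x y = ⁻¹-anti-homo‿- y x

  +-sub-cancelʳ : ∀ u v c → (v ⊕ c) - (u ⊕ c) ≡ v - u
  +-sub-cancelʳ u v c = begin
    (v ⊕ c) - (u ⊕ c)        ≡⟨ cong (λ z → (v ⊕ c) - z) (+-comm u c) ⟩
    (v ⊕ c) ⊕ - (c ⊕ u)      ≡⟨ cong ((v ⊕ c) ⊕_) (-‿anti-homo-+ c u) ⟩
    (v ⊕ c) ⊕ (- u ⊕ - c)    ≡⟨ cong ((v ⊕ c) ⊕_) (+-comm (- u) (- c)) ⟩
    (v ⊕ c) ⊕ (- c ⊕ - u)    ≡⟨ +-assoc (v ⊕ c) (- c) (- u) ⟨
    ((v ⊕ c) - c) ⊕ - u      ≡⟨ cong (_⊕ - u) (x+y-y≡x v c) ⟩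
    v - u                    ∎

  *-distribʳ-sub : ∀ u v a → (v · a) - (u · a) ≡ (v - u) · a
  *-distribʳ-sub u v a = begin
    (v · a) ⊕ - (u · a)    ≡⟨ cong ((v · a) ⊕_) (-‿distribˡ-* u a) ⟩
    (v · a) ⊕ (- u) · a    ≡⟨ distribʳ a v (- u) ⟨
    (v ⊕ - u) · a          ∎

  open Algebra.Properties.CommutativeMonoid.Sum +-commutativeMonoid public
    using (sum; sum-init-last; sum-cong-≗; sum-replicate-zero; sum-permute; ∑-distrib-+; sum-replicate)

  ⨯0≡0 : ∀ n → n ⨯ 0# ≡ 0#
  ⨯0≡0 zero    = refl
  ⨯0≡0 (suc n) = trans (+-identityˡ _) (⨯0≡0 n)

  multiple-of-char⨯≡0 : ∀ {p k} → p ⨯ 1# ≡ 0# → p ∣ k → ∀ z → k ⨯ z ≡ 0#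
  multiple-of-char⨯≡0 {p} p⨯1≡0 (divides d refl) z = begin
    (d * p) ⨯ z           ≡⟨ ×-assocˡ z d p ⟨
    d ⨯ (p ⨯ z)           ≡⟨ cong (λ w → d ⨯ (p ⨯ w)) (*-identityˡ z) ⟨
    d ⨯ (p ⨯ (1# · z))    ≡⟨ cong (d ⨯_) (×-assoc-* p 1# z) ⟨
    d ⨯ ((p ⨯ 1#) · z)    ≡⟨ cong (λ w → d ⨯ (w · z)) p⨯1≡0 ⟩
    d ⨯ (0# · z)          ≡⟨ cong (d ⨯_) (zeroˡ z) ⟩
    d ⨯ 0#                ≡⟨ ⨯0≡0 d ⟩
    0#                    ∎
    where
    open Algebra.Properties.Semiring.Mult semiring using (×-assoc-*)
    open Algebra.Properties.Monoid.Mult +-monoid using (×-assocˡ)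

  sum-outer : ∀ m (t : Fin (suc (suc m)) → Carrier) → (∀ i → t (Fin.suc (Fin.inject₁ i)) ≡ 0#) →
              sum t ≡ t Fin.zero ⊕ t (Fin.fromℕ (suc m))
  sum-outer m t inner≡0 = cong (t Fin.zero ⊕_) (begin
    sum (t ∘ Fin.suc)                                        ≡⟨ sum-init-last (t ∘ Fin.suc) ⟩
    sum (t ∘ Fin.suc ∘ Fin.inject₁) ⊕ t (Fin.fromℕ (suc m))  ≡⟨ cong (_⊕ t (Fin.fromℕ (suc m))) inner ⟩
    0# ⊕ t (Fin.fromℕ (suc m))                              ≡⟨ +-identityˡ _ ⟩
    t (Fin.fromℕ (suc m))                                    ∎)
    where
    inner : sum (t ∘ Fin.suc ∘ Fin.inject₁) ≡ 0#
    inner = trans (sum-cong-≗ inner≡0) (sum-replicate-zero m)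

  -- the binomial coefficients p C k with 0 < k < p vanish in characteristic p
  freshman's-dream : ∀ {p} → Prime p → p ⨯ 1# ≡ 0# → ∀ x y → (x ⊕ y) ^ᶠ p ≡ x ^ᶠ p ⊕ y ^ᶠ p
  freshman's-dream {p@(suc (suc m))} isPrime p⨯1≡0 x y = begin
    (x ⊕ y) ^ᶠ p                       ≡⟨ ^ᶠ≡^ˢ (x ⊕ y) p ⟩
    (x ⊕ y) ^ˢ p                       ≡⟨ Binomial.theorem p x y ⟩
    Binomial.binomialExpansion x y p   ≡⟨ sum-outer (suc m) term inner ⟩
    term Fin.zero ⊕ term (Fin.fromℕ p) ≡⟨ cong₂ _⊕_ first last ⟩
    y ^ᶠ p ⊕ x ^ᶠ p                    ≡⟨ +-comm _ _ ⟩
    x ^ᶠ p ⊕ y ^ᶠ p                    ∎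
    where
    module Binomial = Algebra.Properties.CommutativeSemiring.Binomial commutativeSemiring
    term = Binomial.binomialTerm x y p
    first : term Fin.zero ≡ y ^ᶠ p
    first = trans (+-identityʳ _) (trans (*-identityˡ _) (sym (^ᶠ≡^ˢ y p)))
    term-at : ∀ k {j} → Fin.toℕ k ≡ j → term k ≡ (p C j) ⨯ (x ^ˢ j · y ^ˢ (p ∸ j))
    term-at k refl = refl
    last : term (Fin.fromℕ p) ≡ x ^ᶠ p
    last = begin
      term (Fin.fromℕ p)                 ≡⟨ term-at (Fin.fromℕ p) (Fin.toℕ-fromℕ p) ⟩
      (p C p) ⨯ (x ^ˢ p · y ^ˢ (p ∸ p))  ≡⟨ cong₂ (λ c e → c ⨯ (x ^ˢ p · y ^ˢ e)) (nCn≡1 p) (ℕ.n∸n≡0 p) ⟩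
      1 ⨯ (x ^ˢ p · 1#)                  ≡⟨ trans (+-identityʳ _) (*-identityʳ _) ⟩
      x ^ˢ p                             ≡⟨ ^ᶠ≡^ˢ x p ⟨
      x ^ᶠ p                             ∎
    inner : ∀ i → term (Fin.suc (Fin.inject₁ i)) ≡ 0#
    inner i = trans (term-at _ (cong suc (Fin.toℕ-inject₁ i)))
      (multiple-of-char⨯≡0 p⨯1≡0 (prime∣pCk isPrime (s≤s z≤n) (s≤s (Fin.toℕ<n i))) _)

module FiniteField (F : Field) {q : ℕ} (enumeration : Fin q ↔ Field.Carrier F) where

  open FieldProperties F
  open ≡-Reasoning
  open Inverse enumeration using (to; from; strictlyInverseˡ; strictlyInverseʳ)

  infix 4 _≟_
  _≟_ : (x y : Carrier) → Dec (x ≡ y)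
  x ≟ y with from x Fin.≟ from y
  ... | yes eq = yes (trans (sym (strictlyInverseˡ x)) (trans (cong to eq) (strictlyInverseˡ y)))
  ... | no ¬eq = no (¬eq ∘ cong from)

  -- adding 1 permutes the field, so it leaves the sum of all its elements unchanged
  q⨯1≡0 : q ⨯ 1# ≡ 0#
  q⨯1≡0 = sym (begin
    0#                      ≡⟨ -‿inverseʳ (sum to) ⟨
    sum to - sum to         ≡⟨ cong (_- sum to) sum≡sum+q⨯1 ⟩
    (sum to ⊕ q ⨯ 1#) - sum to ≡⟨ [x+y]-x≡y (sum to) (q ⨯ 1#) ⟩
    q ⨯ 1#                  ∎)
    where
    +1 : Permutation.Permutation q q
    +1 = Permutation.permutation (λ i → from (to i ⊕ 1#)) (λ i → from (to i - 1#))
           (λ i → trans (cong (λ z → from (z ⊕ 1#)) (strictlyInverseˡ _))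
                        (trans (cong from (x-y+y≡x (to i) 1#)) (strictlyInverseʳ i)))
           (λ i → trans (cong (λ z → from (z - 1#)) (strictlyInverseˡ _))
                        (trans (cong from (x+y-y≡x (to i) 1#)) (strictlyInverseʳ i)))
    sum≡sum+q⨯1 : sum to ≡ sum to ⊕ q ⨯ 1#
    sum≡sum+q⨯1 = begin
      sum to                                 ≡⟨ sum-permute to +1 ⟩
      sum (λ i → to (from (to i ⊕ 1#)))      ≡⟨ sum-cong-≗ (λ i → strictlyInverseˡ (to i ⊕ 1#)) ⟩
      sum (λ i → to i ⊕ 1#)                  ≡⟨ ∑-distrib-+ to (λ _ → 1#) ⟩
      sum to ⊕ sum {q} (λ _ → 1#)            ≡⟨ cong (sum to ⊕_) (sum-replicate q) ⟩
      sum to ⊕ q ⨯ 1#                        ∎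

  characteristic : ∀ {p} R → q ≡ p ^ R → p ⨯ 1# ≡ 0#
  characteristic {p} R q≡p^R with p ⨯ 1# ≟ 0#
  ... | yes p⨯1≡0 = p⨯1≡0
  ... | no  p⨯1≢0 = ⊥-elim (^-≢0 R p⨯1≢0 (begin
    (p ⨯ 1#) ^ᶠ R    ≡⟨ ⨯1-^ R ⟨
    (p ^ R) ⨯ 1#     ≡⟨ cong (_⨯ 1#) q≡p^R ⟨
    q ⨯ 1#           ≡⟨ q⨯1≡0 ⟩
    0#               ∎))
    where
    open Algebra.Properties.Semiring.Mult semiring using (×1-homo-*)
    ⨯1-^ : ∀ n → (p ^ n) ⨯ 1# ≡ (p ⨯ 1#) ^ᶠ n
    ⨯1-^ zero    = +-identityʳ 1#
    ⨯1-^ (suc n) = trans (×1-homo-* p (p ^ n)) (cong ((p ⨯ 1#) ·_) (⨯1-^ n))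

module PrimitiveElement (F : Field) {q : ℕ} (enumeration : Fin q ↔ Field.Carrier F)
  (ω : Field.Carrier F) (ω≢0 : ω ≢ Field.0# F)
  (generates : ∀ x → x ≢ Field.0# F → ∃[ k ] (x ≡ Field._^_ F ω k)) where

  open FieldProperties F
  open FiniteField F enumeration
  open Inverse enumeration using (to; from; strictlyInverseˡ; strictlyInverseʳ)
  open ≡-Reasoning

  ω^_ : ℕ → Carrier
  ω^ k = ω ^ᶠ k

  ω^≢0 : ∀ k → ω^ k ≢ 0#
  ω^≢0 k = ^-≢0 k ω≢0

  ω^-∸ : ∀ {a b} → a ≤ b → ω^ a ≡ ω^ b → ω^ (b ∸ a) ≡ 1#
  ω^-∸ {a} {b} a≤b ω^a≡ω^b = *-cancelʳ (ω^ (b ∸ a)) 1# (ω^≢0 a) (begin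
    ω^ (b ∸ a) · ω^ a   ≡⟨ ^-+ ω (b ∸ a) a ⟨
    ω^ (b ∸ a + a)      ≡⟨ cong ω^_ (ℕ.m∸n+n≡m a≤b) ⟩
    ω^ b                ≡⟨ ω^a≡ω^b ⟨
    ω^ a                ≡⟨ *-identityˡ (ω^ a) ⟨
    1# · ω^ a           ∎)

  -- two of the q + 1 powers ω^0, …, ω^q coincide
  ω^-periodic : ∃[ n ] (1 ≤ n × ω^ n ≡ 1#)
  ω^-periodic with Fin.pigeonhole (ℕ.n<1+n q) (λ k → from (ω^ Fin.toℕ k))
  ... | i , j , i<j , eq = Fin.toℕ j ∸ Fin.toℕ i , ℕ.m<n⇒0<n∸m i<j ,
        ω^-∸ (ℕ.<⇒≤ i<j) (trans (sym (strictlyInverseˡ _)) (trans (cong to eq) (strictlyInverseˡ _)))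

  -- nothing below computes with the terms in this and the later abstract blocks,
  -- and letting with-abstraction unfold them is very costly
  abstract
    order-spec : ∃ (LeastPositive (λ n → ω^ n ≡ 1#))
    order-spec = leastPositive (λ n → ω^ n ≟ 1#) (proj₁ (proj₂ ω^-periodic)) (proj₂ (proj₂ ω^-periodic))

  order : ℕ
  order = proj₁ order-spec

  order≥1 : 1 ≤ order
  order≥1 = proj₁ (proj₂ order-spec)

  ω^order≡1 : ω^ order ≡ 1#
  ω^order≡1 = proj₁ (proj₂ (proj₂ order-spec))

  instance
    order-nonZero : NonZero order
    order-nonZero = >-nonZero order≥1

  ω^-+*order : ∀ a k → ω^ (a + k * order) ≡ ω^ a
  ω^-+*order a k = begin
    ω^ (a + k * order)           ≡⟨ ^-+ ω a (k * order) ⟩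
    ω^ a · ω^ (k * order)        ≡⟨ cong (λ e → ω^ a · ω^ e) (ℕ.*-comm k order) ⟩
    ω^ a · ω^ (order * k)        ≡⟨ cong (ω^ a ·_) (^-* ω order k) ⟩
    ω^ a · (ω^ order) ^ᶠ k       ≡⟨ cong (λ z → ω^ a · z ^ᶠ k) ω^order≡1 ⟩
    ω^ a · 1# ^ᶠ k               ≡⟨ cong (ω^ a ·_) (1^ k) ⟩
    ω^ a · 1#                    ≡⟨ *-identityʳ (ω^ a) ⟩
    ω^ a                         ∎
    where
    1^ : ∀ k → 1# ^ᶠ k ≡ 1#
    1^ zero    = refl
    1^ (suc k) = trans (*-identityˡ _) (1^ k)

  ω^-cong : ∀ {a b} → a ≡ b mod order → ω^ a ≡ ω^ b
  ω^-cong {a} {b} (x , y , eq) = trans (sym (ω^-+*order a x)) (trans (cong ω^_ eq) (ω^-+*order b y))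

  order-least : ∀ j → 1 ≤ j → j < order → ω^ j ≢ 1#
  order-least = proj₂ (proj₂ (proj₂ order-spec))

  ω^∸≡1⇒≡ : ∀ {a b} → a ≤ b → b < order → ω^ (b ∸ a) ≡ 1# → a ≡ b
  ω^∸≡1⇒≡ {a} {b} a≤b b<o ω^b∸a≡1 with b ∸ a ℕ.≟ 0
  ... | yes b∸a≡0 = ℕ.≤-antisym a≤b (ℕ.m∸n≡0⇒m≤n b∸a≡0)
  ... | no  b∸a≢0 = ⊥-elim (order-least (b ∸ a) (ℕ.n≢0⇒n>0 b∸a≢0) (ℕ.≤-<-trans (ℕ.m∸n≤m b a) b<o) ω^b∸a≡1)

  ω^-injective-< : ∀ {a b} → a < order → b < order → ω^ a ≡ ω^ b → a ≡ b
  ω^-injective-< {a} {b} a<o b<o eq with ℕ.≤-total a b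
  ... | inj₁ a≤b = ω^∸≡1⇒≡ a≤b b<o (ω^-∸ a≤b eq)
  ... | inj₂ b≤a = sym (ω^∸≡1⇒≡ b≤a a<o (ω^-∸ b≤a (sym eq)))

  ω^-injective : ∀ {a b} → ω^ a ≡ ω^ b → a ≡ b mod order
  ω^-injective {a} {b} eq = mod-trans (%-mod a) (mod-trans
    (mod-reflexive (ω^-injective-< (m%n<n a order) (m%n<n b order) ω^a%o≡ω^b%o)) (mod-sym (%-mod b)))
    where
    ω^a%o≡ω^b%o : ω^ (a % order) ≡ ω^ (b % order)
    ω^a%o≡ω^b%o = trans (sym (ω^-cong (%-mod a))) (trans eq (ω^-cong (%-mod b)))

  log : ∀ x → x ≢ 0# → ℕ
  log x x≢0 = proj₁ (generates x x≢0) % order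

  log<order : ∀ x x≢0 → log x x≢0 < order
  log<order x x≢0 = m%n<n _ order

  ω^log : ∀ x x≢0 → ω^ log x x≢0 ≡ x
  ω^log x x≢0 = trans (sym (ω^-cong (%-mod (proj₁ (generates x x≢0))))) (sym (proj₂ (generates x x≢0)))

  -- 0 together with the powers ω^k, k < order, enumerate the field
  1+order≡q : suc order ≡ q
  1+order≡q = Permutation.↔⇒≡ (↔-trans (mk↔ₛ′ power logarithm power∘logarithm logarithm∘power) (↔-sym enumeration))
    where
    power : Fin (suc order) → Carrier
    power Fin.zero    = 0#
    power (Fin.suc k) = ω^ Fin.toℕ k
    logarithm : Carrier → Fin (suc order)
    logarithm x with x ≟ 0#
    ... | yes _   = Fin.zero
    ... | no  x≢0 = Fin.suc (Fin.fromℕ< (log<order x x≢0))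
    power∘logarithm : ∀ x → power (logarithm x) ≡ x
    power∘logarithm x with x ≟ 0#
    ... | yes x≡0 = sym x≡0
    ... | no  x≢0 = trans (cong ω^_ (Fin.toℕ-fromℕ< (log<order x x≢0))) (ω^log x x≢0)
    logarithm∘power : ∀ k → logarithm (power k) ≡ k
    logarithm∘power Fin.zero with 0# ≟ 0#
    ... | yes _   = refl
    ... | no  0≢0 = ⊥-elim (0≢0 refl)
    logarithm∘power (Fin.suc k) with ω^ Fin.toℕ k ≟ 0#
    ... | yes ω^k≡0 = ⊥-elim (ω^≢0 (Fin.toℕ k) ω^k≡0)
    ... | no  ω^k≢0 = cong Fin.suc (Fin.toℕ-injective (trans (Fin.toℕ-fromℕ< (log<order _ ω^k≢0))
                        (ω^-injective-< (log<order _ ω^k≢0) (Fin.toℕ<n k) (ω^log _ ω^k≢0))))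

  module Frobenius {p R : ℕ} (isPrime : Prime p) (R≥1 : 1 ≤ R) (q≡p^R : q ≡ p ^ R) where

    instance
      p-nonZero : NonZero p
      p-nonZero = prime⇒nonZero isPrime

    frobenius-+ : ∀ x y → (x ⊕ y) ^ᶠ p ≡ x ^ᶠ p ⊕ y ^ᶠ p
    frobenius-+ = freshman's-dream isPrime (characteristic R q≡p^R)

    frobenius-sub : ∀ x y → x ^ᶠ p - y ^ᶠ p ≡ (x - y) ^ᶠ p
    frobenius-sub x y = begin
      x ^ᶠ p - y ^ᶠ p                     ≡⟨ cong (λ z → z ^ᶠ p - y ^ᶠ p) (x-y+y≡x x y) ⟨
      ((x - y) ⊕ y) ^ᶠ p - y ^ᶠ p         ≡⟨ cong (_- y ^ᶠ p) (frobenius-+ (x - y) y) ⟩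
      ((x - y) ^ᶠ p ⊕ y ^ᶠ p) - y ^ᶠ p    ≡⟨ x+y-y≡x _ _ ⟩
      (x - y) ^ᶠ p                        ∎

    ^p^-suc : ∀ x j → (x ^ᶠ p) ^ᶠ (p ^ j) ≡ x ^ᶠ (p ^ suc j)
    ^p^-suc x j = sym (^-* x p (p ^ j))

    frobenius-injective : ∀ {x y} → x ^ᶠ p ≡ y ^ᶠ p → x ≡ y
    frobenius-injective {x} {y} eq with x - y ≟ 0#
    ... | yes x-y≡0 = x-y≡0⇒x≡y x-y≡0
    ... | no  x-y≢0 = ⊥-elim (^-≢0 p x-y≢0 (begin
      (x - y) ^ᶠ p      ≡⟨ frobenius-sub x y ⟨
      x ^ᶠ p - y ^ᶠ p   ≡⟨ cong (_- y ^ᶠ p) eq ⟩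
      y ^ᶠ p - y ^ᶠ p   ≡⟨ -‿inverseʳ (y ^ᶠ p) ⟩
      0#                ∎))

    -- ω^k is the p-th power of ω^(k p^(R-1)), since ω^(p^R) = ω^(1 + order) = ω
    frobenius-surjective : ∀ w → ∃[ x ] (x ^ᶠ p ≡ w)
    frobenius-surjective w with w ≟ 0#
    ... | yes w≡0 = 0# , trans (0^ p) (sym w≡0)
    ... | no  w≢0 with generates w w≢0
    ...   | k , w≡ω^k = ω^ (k * p ^ pred R) , (begin
      (ω^ (k * p ^ pred R)) ^ᶠ p     ≡⟨ ^-* ω (k * p ^ pred R) p ⟨
      ω^ (k * p ^ pred R * p)        ≡⟨ cong ω^_ (trans (ℕ.*-assoc k _ p) (cong (k *_) p^R-1*p≡1+order)) ⟩
      ω^ (k * suc order)               ≡⟨ cong ω^_ (trans (ℕ.*-suc k order) (cong (k +_) (ℕ.*-comm k order))) ⟩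
      ω^ (k + order * k)               ≡⟨ cong (λ e → ω^ (k + e)) (ℕ.*-comm order k) ⟩
      ω^ (k + k * order)               ≡⟨ ω^-+*order k k ⟩
      ω^ k                             ≡⟨ w≡ω^k ⟨
      w                                ∎)
      where
      p^R-1*p≡1+order : p ^ pred R * p ≡ suc order
      p^R-1*p≡1+order = begin
        p ^ pred R * p      ≡⟨ ℕ.*-comm _ p ⟩
        p ^ suc (pred R)    ≡⟨ cong (p ^_) (ℕ.suc-pred R {{>-nonZero R≥1}}) ⟩
        p ^ R               ≡⟨ q≡p^R ⟨
        q                   ≡⟨ 1+order≡q ⟨
        suc order           ∎

    ^p^-injective : ∀ j {x y} → x ^ᶠ (p ^ j) ≡ y ^ᶠ (p ^ j) → x ≡ y
    ^p^-injective zero    {x} {y} eq = trans (sym (*-identityʳ x)) (trans eq (*-identityʳ y))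
    ^p^-injective (suc j) {x} {y} eq =
      frobenius-injective (^p^-injective j (trans (^p^-suc x j) (trans eq (sym (^p^-suc y j)))))

    ^p^-surjective : ∀ j w → ∃[ x ] (x ^ᶠ (p ^ j) ≡ w)
    ^p^-surjective zero    w = w , *-identityʳ w
    ^p^-surjective (suc j) w with ^p^-surjective j w
    ... | y , y^p^j≡w with frobenius-surjective y
    ...   | x , x^p≡y = x , trans (sym (^p^-suc x j)) (trans (cong (_^ᶠ (p ^ j)) x^p≡y) y^p^j≡w)

-- Exponents of ω modulo 4h

module Exponents {p h : ℕ} (p%4≡3 : p % 4 ≡ 3) (h≥1 : 1 ≤ h) (h%2≡1 : h % 2 ≡ 1)
                 (2h∣p∸1 : 2 * h ∣ p ∸ 1) where

  K : ℕ
  K = 4 * h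

  instance
    K-nonZero : NonZero K
    K-nonZero = >-nonZero (ℕ.≤-trans h≥1 (ℕ.m≤m+n h _))

    2h-nonZero : NonZero (2 * h)
    2h-nonZero = >-nonZero (ℕ.≤-trans h≥1 (ℕ.m≤m+n h _))

  s : ℕ
  s = h / 2

  h≡1+2s : h ≡ 1 + 2 * s
  h≡1+2s = trans (m≡m%n+[m/n]*n h 2) (cong₂ _+_ h%2≡1 (ℕ.*-comm s 2))

  instance
    p-nonZero : NonZero p
    p-nonZero = ≢-nonZero λ p≡0 → 0%4≢3 (subst (λ x → x % 4 ≡ 3) p≡0 p%4≡3)
      where 0%4≢3 : 0 % 4 ≢ 3
            0%4≢3 ()

  private
    m : ℕ
    m = _∣_.quotient 2h∣p∸1

  p≡1+m*2h : p ≡ 1 + m * (2 * h)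
  p≡1+m*2h = trans (sym (ℕ.suc-pred p)) (cong suc (_∣_.equality 2h∣p∸1))

  private
    t : ℕ
    t = p / 4

  p≡3+t*4 : p ≡ 3 + t * 4
  p≡3+t*4 = trans (m≡m%n+[m/n]*n p 4) (cong (_+ t * 4) p%4≡3)

  -- m is odd: otherwise p ≡ 1 (mod 4)
  m-odd : ∃[ u ] (m ≡ 1 + u * 2)
  m-odd with m % 2 | m%n<n m 2 | m≡m%n+[m/n]*n m 2
  ... | 1 | _ | m≡1+[m/2]*2 = m / 2 , m≡1+[m/2]*2
  ... | 0 | _ | m≡[m/2]*2 = ⊥-elim (1%4≢3 (begin
    1 % 4                                ≡⟨ [m+kn]%n≡m%n 1 (h * (m / 2)) 4 ⟨
    (1 + h * (m / 2) * 4) % 4            ≡⟨ cong (_% 4) p≡1+h*[m/2]*4 ⟨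
    p % 4                                ≡⟨ p%4≡3 ⟩
    3                                    ∎))
    where
    open ≡-Reasoning
    1%4≢3 : 1 % 4 ≢ 3
    1%4≢3 ()
    regroup : ∀ h w → 1 + (0 + w * 2) * (2 * h) ≡ 1 + h * w * 4
    regroup = solve-∀
    p≡1+h*[m/2]*4 : p ≡ 1 + h * (m / 2) * 4
    p≡1+h*[m/2]*4 = trans p≡1+m*2h (trans (cong (λ x → 1 + x * (2 * h)) m≡[m/2]*2) (regroup h (m / 2)))
  ... | suc (suc _) | s≤s (s≤s ()) | _

  private
    u : ℕ
    u = proj₁ m-odd

  p≡1+2h+u*K : p ≡ 1 + 2 * h + u * K
  p≡1+2h+u*K = trans p≡1+m*2h (trans (cong (λ x → 1 + x * (2 * h)) (proj₂ m-odd)) (regroup h u))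
    where
    regroup : ∀ h u → 1 + (1 + u * 2) * (2 * h) ≡ 1 + 2 * h + u * (4 * h)
    regroup = solve-∀

  -- p² - 1 = (p - 1)(p + 1) with 2h ∣ p - 1 and 4 ∣ p + 1
  p*p≡1+8h*c : ∃[ c ] (p * p ≡ 1 + 8 * h * c)
  p*p≡1+8h*c = m * (1 + t) , (begin
    p * p                              ≡⟨ cong (_* p) p≡1+m*2h ⟩
    (1 + m * (2 * h)) * p              ≡⟨ expand m h p ⟩
    p + m * (2 * h) * p                ≡⟨ cong (_+ m * (2 * h) * p) p≡1+m*2h ⟩
    1 + m * (2 * h) + m * (2 * h) * p  ≡⟨ factor m h p ⟩
    1 + m * (2 * h) * (1 + p)          ≡⟨ cong (λ x → 1 + m * (2 * h) * (1 + x)) p≡3+t*4 ⟩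
    1 + m * (2 * h) * (1 + (3 + t * 4)) ≡⟨ collect m h t ⟩
    1 + 8 * h * (m * (1 + t))          ∎)
    where
    open ≡-Reasoning
    expand : ∀ m h p → (1 + m * (2 * h)) * p ≡ p + m * (2 * h) * p
    expand = solve-∀
    factor : ∀ m h p → 1 + m * (2 * h) + m * (2 * h) * p ≡ 1 + m * (2 * h) * (1 + p)
    factor = solve-∀
    collect : ∀ m h t → 1 + m * (2 * h) * (1 + (3 + t * 4)) ≡ 1 + 8 * h * (m * (1 + t))
    collect = solve-∀

  2a*p≡2a : ∀ a → 2 * a * p ≡ 2 * a mod K
  2a*p≡2a a = begin
    2 * a * p                                ≡⟨ cong (2 * a *_) p≡1+2h+u*K ⟩
    2 * a * (1 + 2 * h + u * K)              ≡⟨ expand a h u ⟩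
    2 * a + (a + 2 * a * u) * K              ≈⟨ +*-mod (2 * a) (a + 2 * a * u) ⟩
    2 * a                                    ∎
    where
    open ≡-mod-Reasoning K
    expand : ∀ a h u → 2 * a * (1 + 2 * h + u * (4 * h)) ≡ 2 * a + (a + 2 * a * u) * (4 * h)
    expand = solve-∀

  [1+2a]*p≡1+2a+2h : ∀ a → (1 + 2 * a) * p ≡ 1 + 2 * a + 2 * h mod K
  [1+2a]*p≡1+2a+2h a = begin
    (1 + 2 * a) * p                          ≡⟨ cong ((1 + 2 * a) *_) p≡1+2h+u*K ⟩
    (1 + 2 * a) * (1 + 2 * h + u * K)        ≡⟨ expand a h u ⟩
    1 + 2 * a + 2 * h + (a + (1 + 2 * a) * u) * K ≈⟨ +*-mod (1 + 2 * a + 2 * h) (a + (1 + 2 * a) * u) ⟩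
    1 + 2 * a + 2 * h                        ∎
    where
    open ≡-mod-Reasoning K
    expand : ∀ a h u → (1 + 2 * a) * (1 + 2 * h + u * (4 * h))
                       ≡ 1 + 2 * a + 2 * h + (a + (1 + 2 * a) * u) * (4 * h)
    expand = solve-∀

  *p*p≡id : ∀ a → a * p * p ≡ a mod K
  *p*p≡id a with p*p≡1+8h*c
  ... | c , p*p≡1+8h*c = begin
    a * p * p                  ≡⟨ trans (ℕ.*-assoc a p p) (cong (a *_) p*p≡1+8h*c) ⟩
    a * (1 + 8 * h * c)        ≡⟨ expand a h c ⟩
    a + 2 * a * c * K          ≈⟨ +*-mod a (2 * a * c) ⟩
    a                          ∎
    where
    open ≡-mod-Reasoning K
    expand : ∀ a h c → a * (1 + 8 * h * c) ≡ a + 2 * a * c * (4 * h)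
    expand = solve-∀

  *p-cancel : ∀ {a b} → a * p ≡ b * p mod K → a ≡ b mod K
  *p-cancel {a} {b} ap≡bp = begin
    a          ≈⟨ *p*p≡id a ⟨
    a * p * p  ≈⟨ *-mod-congʳ p ap≡bp ⟩
    b * p * p  ≈⟨ *p*p≡id b ⟩
    b          ∎
    where open ≡-mod-Reasoning K

  p^j≡1⊎p^j≡p : ∀ j → p ^ j ≡ 1 mod K ⊎ p ^ j ≡ p mod K
  p^j≡1⊎p^j≡p zero = inj₁ mod-refl
  p^j≡1⊎p^j≡p (suc j) with p^j≡1⊎p^j≡p j
  ... | inj₁ p^j≡1 = inj₂ (begin
    p * p ^ j     ≈⟨ *-mod-congˡ p p^j≡1 ⟩
    p * 1         ≡⟨ ℕ.*-identityʳ p ⟩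
    p             ∎)
    where open ≡-mod-Reasoning K
  ... | inj₂ p^j≡p = inj₁ (begin
    p * p ^ j     ≈⟨ *-mod-congˡ p p^j≡p ⟩
    p * p         ≡⟨ cong (_* p) (ℕ.*-identityˡ p) ⟨
    1 * p * p     ≈⟨ *p*p≡id 1 ⟩
    1             ∎)
    where open ≡-mod-Reasoning K

  <-*h : ∀ {i j} → i < j → i * h < j * h
  <-*h = ℕ.*-monoˡ-< h {{>-nonZero h≥1}}

  h<K : h < K
  h<K = subst (_< K) (ℕ.*-identityˡ h) (<-*h {1} {4} (s≤s (s≤s z≤n)))

  2h<K : 2 * h < K
  2h<K = <-*h {2} {4} (s≤s (s≤s (s≤s z≤n)))

  3h<K : 3 * h < K
  3h<K = <-*h {3} {4} (s≤s (s≤s (s≤s (s≤s z≤n))))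

  2i<K : ∀ {i} → i < 2 * h → 2 * i < K
  2i<K {i} i<2h = ℕ.<-≤-trans (ℕ.*-monoʳ-< 2 i<2h) (ℕ.≤-reflexive (double h))
    where
    double : ∀ h → 2 * (2 * h) ≡ 4 * h
    double = solve-∀

  2i+3h-odd : ∀ i → 2 * i + 3 * h ≡ 1 + 2 * (i + 1 + 3 * s)
  2i+3h-odd i = trans (cong (λ x → 2 * i + 3 * x) h≡1+2s) (regroup i s)
    where
    regroup : ∀ i s → 2 * i + 3 * (1 + 2 * s) ≡ 1 + 2 * (i + 1 + 3 * s)
    regroup = solve-∀

  K≡2*2h : K ≡ 2 * (2 * h)
  K≡2*2h = regroup h
    where
    regroup : ∀ h → 4 * h ≡ 2 * (2 * h)
    regroup = solve-∀

  2i≢2j+3h : ∀ i j → ¬ (2 * i ≡ 2 * j + 3 * h mod K)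
  2i≢2j+3h i j 2i≡2j+3h =
    even≢odd-mod (2 * h) {i} {j + 1 + 3 * s} (subst (λ M → 2 * i ≡ 1 + 2 * (j + 1 + 3 * s) mod M) K≡2*2h
                                                (mod-trans 2i≡2j+3h (mod-reflexive (2i+3h-odd j))))

  -- Class i a: ω^a lies in ω^(2i) S, the set of differences of the part E i
  Class : ℕ → ℕ → Set
  Class i a = a ≡ 2 * i mod K ⊎ a ≡ 2 * i + 3 * h mod K

  Class-resp : ∀ {i a b} → a ≡ b mod K → Class i b → Class i a
  Class-resp a≡b (inj₁ b≡2i)    = inj₁ (mod-trans a≡b b≡2i)
  Class-resp a≡b (inj₂ b≡2i+3h) = inj₂ (mod-trans a≡b b≡2i+3h)

  Class-unique : ∀ {i j a} → i < 2 * h → j < 2 * h → Class i a → Class j a → i ≡ j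
  Class-unique {i} {j} i<2h j<2h (inj₁ a≡2i) (inj₁ a≡2j) =
    ℕ.*-cancelˡ-≡ i j 2 (mod-<⇒≡ (2i<K i<2h) (2i<K j<2h) (mod-trans (mod-sym a≡2i) a≡2j))
  Class-unique {i} {j} _ _ (inj₁ a≡2i) (inj₂ a≡2j+3h) = ⊥-elim (2i≢2j+3h i j (mod-trans (mod-sym a≡2i) a≡2j+3h))
  Class-unique {i} {j} _ _ (inj₂ a≡2i+3h) (inj₁ a≡2j) = ⊥-elim (2i≢2j+3h j i (mod-trans (mod-sym a≡2j) a≡2i+3h))
  Class-unique {i} {j} i<2h j<2h (inj₂ a≡2i+3h) (inj₂ a≡2j+3h) =
    ℕ.*-cancelˡ-≡ i j 2 (mod-<⇒≡ (2i<K i<2h) (2i<K j<2h)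
      (+-mod-cancelʳ (3 * h) (mod-trans (mod-sym a≡2i+3h) a≡2j+3h)))

  part : ℕ → Fin (2 * h)
  part x = Fin.fromℕ< (m%n<n x (2 * h))

  2x≡2[part-x] : ∀ x → 2 * x ≡ 2 * Fin.toℕ (part x) mod K
  2x≡2[part-x] x = begin
    2 * x                                  ≡⟨ cong (2 *_) (m≡m%n+[m/n]*n x (2 * h)) ⟩
    2 * (x % (2 * h) + x / (2 * h) * (2 * h)) ≡⟨ distribute (x % (2 * h)) (x / (2 * h)) h ⟩
    2 * (x % (2 * h)) + x / (2 * h) * K    ≈⟨ +*-mod (2 * (x % (2 * h))) (x / (2 * h)) ⟩
    2 * (x % (2 * h))                      ≡⟨ cong (2 *_) (Fin.toℕ-fromℕ< (m%n<n x (2 * h))) ⟨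
    2 * Fin.toℕ (part x)                   ∎
    where
    open ≡-mod-Reasoning K
    distribute : ∀ r k h → 2 * (r + k * (2 * h)) ≡ 2 * r + k * (4 * h)
    distribute = solve-∀

  Class-part : ∀ x a → Class x a ⟺ Class (Fin.toℕ (part x)) a
  Class-part x a = to , from
    where
    to : Class x a → Class (Fin.toℕ (part x)) a
    to (inj₁ a≡2x)    = inj₁ (mod-trans a≡2x (2x≡2[part-x] x))
    to (inj₂ a≡2x+3h) = inj₂ (mod-trans a≡2x+3h (+-mod-congʳ (3 * h) (2x≡2[part-x] x)))
    from : Class (Fin.toℕ (part x)) a → Class x a
    from (inj₁ a≡2i)    = inj₁ (mod-trans a≡2i (mod-sym (2x≡2[part-x] x)))
    from (inj₂ a≡2i+3h) = inj₂ (mod-trans a≡2i+3h (mod-sym (+-mod-congʳ (3 * h) (2x≡2[part-x] x))))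

  -- an odd a is congruent to a + 4h = (a + h) + 3h, and a + h is even
  Class-cover : ∀ a → ∃[ i ] Class (Fin.toℕ {2 * h} i) a
  Class-cover a with a % 2 | m%n<n a 2 | m≡m%n+[m/n]*n a 2
  ... | 0 | _ | a≡w*2 = part (a / 2) , proj₁ (Class-part _ a) (inj₁ (mod-reflexive (trans a≡w*2 (ℕ.*-comm (a / 2) 2))))
  ... | 1 | _ | a≡1+w*2 = part (a / 2 + s + 1) , proj₁ (Class-part _ a) (inj₂ (begin
    a                                  ≈⟨ +-mod-modulus a ⟨
    a + 4 * h                          ≡⟨ cong (_+ 4 * h) a≡1+w*2 ⟩
    1 + a / 2 * 2 + 4 * h              ≡⟨ split (a / 2) h ⟩
    1 + a / 2 * 2 + h + 3 * h          ≡⟨ cong (λ x → 1 + a / 2 * 2 + x + 3 * h) h≡1+2s ⟩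
    1 + a / 2 * 2 + (1 + 2 * s) + 3 * h ≡⟨ regroup (a / 2) s h ⟩
    2 * (a / 2 + s + 1) + 3 * h        ∎))
    where
    open ≡-mod-Reasoning K
    split : ∀ w h → 1 + w * 2 + 4 * h ≡ 1 + w * 2 + h + 3 * h
    split = solve-∀
    regroup : ∀ w s h → 1 + w * 2 + (1 + 2 * s) + 3 * h ≡ 2 * (w + s + 1) + 3 * h
    regroup = solve-∀
  ... | suc (suc _) | s≤s (s≤s ()) | _

  ClassMap : (ℕ → ℕ) → ℕ → ℕ → Set
  ClassMap f i j = ∀ a → Class i a ⟺ Class j (f a)

  shift-ClassMap : ∀ {i j} c → 2 * i + c ≡ 2 * j mod K → ClassMap (_+ c) i j
  shift-ClassMap {i} {j} c 2i+c≡2j a = to , from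
    where
    open ≡-mod-Reasoning K
    swap : 2 * i + 3 * h + c ≡ 2 * i + c + 3 * h
    swap = trans (ℕ.+-assoc (2 * i) (3 * h) c) (trans (cong (2 * i +_) (ℕ.+-comm (3 * h) c)) (sym (ℕ.+-assoc (2 * i) c (3 * h))))
    to : Class i a → Class j (a + c)
    to (inj₁ a≡2i)    = inj₁ (mod-trans (+-mod-congʳ c a≡2i) 2i+c≡2j)
    to (inj₂ a≡2i+3h) = inj₂ (begin
      a + c                ≈⟨ +-mod-congʳ c a≡2i+3h ⟩
      2 * i + 3 * h + c    ≡⟨ swap ⟩
      2 * i + c + 3 * h    ≈⟨ +-mod-congʳ (3 * h) 2i+c≡2j ⟩
      2 * j + 3 * h        ∎)
    from : Class j (a + c) → Class i a
    from (inj₁ a+c≡2j)    = inj₁ (+-mod-cancelʳ c (mod-trans a+c≡2j (mod-sym 2i+c≡2j)))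
    from (inj₂ a+c≡2j+3h) = inj₂ (+-mod-cancelʳ c (begin
      a + c                ≈⟨ a+c≡2j+3h ⟩
      2 * j + 3 * h        ≈⟨ +-mod-congʳ (3 * h) 2i+c≡2j ⟨
      2 * i + c + 3 * h    ≡⟨ swap ⟨
      2 * i + 3 * h + c    ∎))

  frobenius-ClassMap : ∀ {i j} c → (2 * i + c) * p ≡ 2 * j + 3 * h mod K →
                       (2 * i + 3 * h + c) * p ≡ 2 * j mod K → ClassMap (λ a → (a + c) * p) i j
  frobenius-ClassMap {i} {j} c even↦odd odd↦even a = to , from
    where
    to : Class i a → Class j ((a + c) * p)
    to (inj₁ a≡2i)    = inj₂ (mod-trans (*-mod-congʳ p (+-mod-congʳ c a≡2i)) even↦odd)
    to (inj₂ a≡2i+3h) = inj₁ (mod-trans (*-mod-congʳ p (+-mod-congʳ c a≡2i+3h)) odd↦even)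
    from : Class j ((a + c) * p) → Class i a
    from (inj₁ [a+c]p≡2j)    = inj₂ (+-mod-cancelʳ c (*p-cancel (mod-trans [a+c]p≡2j (mod-sym odd↦even))))
    from (inj₂ [a+c]p≡2j+3h) = inj₁ (+-mod-cancelʳ c (*p-cancel (mod-trans [a+c]p≡2j+3h (mod-sym even↦odd))))

  ClassMap-part : ∀ {f i x} → ClassMap f i x → ClassMap f i (Fin.toℕ (part x))
  ClassMap-part {f} {i} {x} i↦x a =
    (λ c → proj₁ (Class-part x (f a)) (proj₁ (i↦x a) c)) , (λ c → proj₂ (i↦x a) (proj₂ (Class-part x (f a)) c))

  +K-ClassMap : ∀ i → ClassMap (_+ K) i i
  +K-ClassMap i = shift-ClassMap {i} {i} K (+-mod-modulus (2 * i))

  [2i+h]*p≡2i+3h : ∀ i → (2 * i + h) * p ≡ 2 * i + 3 * h mod K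
  [2i+h]*p≡2i+3h i = begin
    (2 * i + h) * p               ≡⟨ cong (_* p) 2i+h≡1+2[i+s] ⟩
    (1 + 2 * (i + s)) * p         ≈⟨ [1+2a]*p≡1+2a+2h (i + s) ⟩
    1 + 2 * (i + s) + 2 * h       ≡⟨ cong (_+ 2 * h) 2i+h≡1+2[i+s] ⟨
    2 * i + h + 2 * h             ≡⟨ regroup i h ⟩
    2 * i + 3 * h                 ∎
    where
    open ≡-mod-Reasoning K
    2i+h≡1+2[i+s] : 2 * i + h ≡ 1 + 2 * (i + s)
    2i+h≡1+2[i+s] = trans (cong (2 * i +_) h≡1+2s) (regroup′ i s)
      where
      regroup′ : ∀ i s → 2 * i + (1 + 2 * s) ≡ 1 + 2 * (i + s)
      regroup′ = solve-∀
    regroup : ∀ i h → 2 * i + h + 2 * h ≡ 2 * i + 3 * h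
    regroup = solve-∀

  [2i+3h+h]*p≡2i : ∀ i → (2 * i + 3 * h + h) * p ≡ 2 * i mod K
  [2i+3h+h]*p≡2i i = begin
    (2 * i + 3 * h + h) * p       ≡⟨ cong (_* p) (regroup i h) ⟩
    2 * (i + 2 * h) * p           ≈⟨ 2a*p≡2a (i + 2 * h) ⟩
    2 * (i + 2 * h)               ≡⟨ regroup′ i h ⟩
    2 * i + K                     ≈⟨ +-mod-modulus (2 * i) ⟩
    2 * i                         ∎
    where
    open ≡-mod-Reasoning K
    regroup : ∀ i h → 2 * i + 3 * h + h ≡ 2 * (i + 2 * h)
    regroup = solve-∀
    regroup′ : ∀ i h → 2 * (i + 2 * h) ≡ 2 * i + 4 * h
    regroup′ = solve-∀

  +h*p-ClassMap : ∀ i → ClassMap (λ a → (a + h) * p) i i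
  +h*p-ClassMap i = frobenius-ClassMap {i} {i} h ([2i+h]*p≡2i+3h i) ([2i+3h+h]*p≡2i i)

  +1*p-ClassMap : ∀ i → ClassMap (λ a → (a + 1) * p) i (i + 2 + 3 * s)
  +1*p-ClassMap i = frobenius-ClassMap {i} {i + 2 + 3 * s} 1 even↦odd odd↦even
    where
    open ≡-mod-Reasoning K
    2i+3h+1≡2[i+2+3s] : 2 * i + 3 * h + 1 ≡ 2 * (i + 2 + 3 * s)
    2i+3h+1≡2[i+2+3s] = trans (cong (λ x → 2 * i + 3 * x + 1) h≡1+2s) (regroup i s)
      where
      regroup : ∀ i s → 2 * i + 3 * (1 + 2 * s) + 1 ≡ 2 * (i + 2 + 3 * s)
      regroup = solve-∀
    even↦odd : (2 * i + 1) * p ≡ 2 * (i + 2 + 3 * s) + 3 * h mod K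
    even↦odd = begin
      (2 * i + 1) * p               ≡⟨ cong (_* p) (ℕ.+-comm (2 * i) 1) ⟩
      (1 + 2 * i) * p               ≈⟨ [1+2a]*p≡1+2a+2h i ⟩
      1 + 2 * i + 2 * h             ≈⟨ +-mod-modulus (1 + 2 * i + 2 * h) ⟨
      1 + 2 * i + 2 * h + 4 * h     ≡⟨ regroup i h ⟩
      2 * i + 3 * h + 1 + 3 * h     ≡⟨ cong (_+ 3 * h) 2i+3h+1≡2[i+2+3s] ⟩
      2 * (i + 2 + 3 * s) + 3 * h   ∎
      where
      regroup : ∀ i h → 1 + 2 * i + 2 * h + 4 * h ≡ 2 * i + 3 * h + 1 + 3 * h
      regroup = solve-∀
    odd↦even : (2 * i + 3 * h + 1) * p ≡ 2 * (i + 2 + 3 * s) mod K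
    odd↦even = begin
      (2 * i + 3 * h + 1) * p       ≡⟨ cong (_* p) 2i+3h+1≡2[i+2+3s] ⟩
      2 * (i + 2 + 3 * s) * p       ≈⟨ 2a*p≡2a (i + 2 + 3 * s) ⟩
      2 * (i + 2 + 3 * s)           ∎

  Class-same : ∀ {i a b} → Class i a → Class i b → a ≡ b mod K ⊎ (a + h) * p ≡ b mod K
  Class-same (inj₁ a≡2i)    (inj₁ b≡2i)    = inj₁ (mod-trans a≡2i (mod-sym b≡2i))
  Class-same (inj₂ a≡2i+3h) (inj₂ b≡2i+3h) = inj₁ (mod-trans a≡2i+3h (mod-sym b≡2i+3h))
  Class-same {i} (inj₁ a≡2i) (inj₂ b≡2i+3h) =
    inj₂ (mod-trans (*-mod-congʳ p (+-mod-congʳ h a≡2i)) (mod-trans ([2i+h]*p≡2i+3h i) (mod-sym b≡2i+3h)))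
  Class-same {i} (inj₂ a≡2i+3h) (inj₁ b≡2i) =
    inj₂ (mod-trans (*-mod-congʳ p (+-mod-congʳ h a≡2i+3h)) (mod-trans ([2i+3h+h]*p≡2i i) (mod-sym b≡2i)))

  3h*p≡h : 3 * h * p ≡ h mod K
  3h*p≡h = begin
    3 * h * p            ≡⟨ cong (_* p) (regroup h) ⟩
    (2 * h + h) * p      ≈⟨ [2i+h]*p≡2i+3h h ⟩
    2 * h + 3 * h        ≡⟨ regroup′ h ⟩
    h + K                ≈⟨ +-mod-modulus h ⟩
    h                    ∎
    where
    open ≡-mod-Reasoning K
    regroup : ∀ h → 3 * h ≡ 2 * h + h
    regroup = solve-∀
    regroup′ : ∀ h → 2 * h + 3 * h ≡ h + 4 * h
    regroup′ = solve-∀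

  3h+3h≡2h : 3 * h + 3 * h ≡ 2 * h mod K
  3h+3h≡2h = mod-trans (mod-reflexive (regroup h)) (+-mod-modulus (2 * h))
    where
    regroup : ∀ h → 3 * h + 3 * h ≡ 2 * h + 4 * h
    regroup = solve-∀

  ¬Class0-h : ¬ Class 0 h
  ¬Class0-h (inj₁ h≡0)  = ℕ.<⇒≢ h≥1 (sym (mod-<⇒≡ h<K (ℕ.≤-<-trans z≤n h<K) h≡0))
  ¬Class0-h (inj₂ h≡3h) = ℕ.<⇒≢ h<3h (mod-<⇒≡ h<K 3h<K h≡3h)
    where h<3h = subst (_< 3 * h) (ℕ.*-identityˡ h) (<-*h {1} {3} (s≤s (s≤s z≤n)))

  ¬Class0-2h : ¬ Class 0 (2 * h)
  ¬Class0-2h (inj₁ 2h≡0)  = ℕ.<⇒≢ (<-*h {0} {2} (s≤s z≤n)) (sym (mod-<⇒≡ 2h<K (ℕ.≤-<-trans z≤n h<K) 2h≡0))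
  ¬Class0-2h (inj₂ 2h≡3h) = ℕ.<⇒≢ (<-*h {2} {3} (s≤s (s≤s (s≤s z≤n)))) (mod-<⇒≡ 2h<K 3h<K 2h≡3h)

  -- the two images of 1 = ω^0 and ω^(3h) pin down e according to p^j mod 4h
  Class0-twist : ∀ {P e} → Class 0 e → Class 0 (3 * h * P + e) →
                 (P ≡ 1 mod K → e ≡ 0 mod K) × (P ≡ p mod K → e ≡ 3 * h mod K)
  Class0-twist {P} {e} (inj₁ e≡0) image = (λ _ → e≡0) , λ P≡p → ⊥-elim (¬Class0-h (Class-resp {0} (begin
    h                    ≈⟨ 3h*p≡h ⟨
    3 * h * p            ≈⟨ *-mod-congˡ (3 * h) P≡p ⟨
    3 * h * P            ≡⟨ ℕ.+-identityʳ _ ⟨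
    3 * h * P + 0        ≈⟨ +-mod-congˡ (3 * h * P) e≡0 ⟨
    3 * h * P + e        ∎) image))
    where open ≡-mod-Reasoning K
  Class0-twist {P} {e} (inj₂ e≡3h) image = (λ P≡1 → ⊥-elim (¬Class0-2h (Class-resp {0} (begin
    2 * h                ≈⟨ 3h+3h≡2h ⟨
    3 * h + 3 * h        ≡⟨ cong (_+ 3 * h) (ℕ.*-identityʳ (3 * h)) ⟨
    3 * h * 1 + 3 * h    ≈⟨ +-mod-cong (*-mod-congˡ (3 * h) P≡1) e≡3h ⟨
    3 * h * P + e        ∎) image))) , λ _ → e≡3h
    where open ≡-mod-Reasoning K

  Class0-twist-unique : ∀ j {e e′} → Class 0 e → Class 0 (3 * h * p ^ j + e) →
                        Class 0 e′ → Class 0 (3 * h * p ^ j + e′) → e ≡ e′ mod K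
  Class0-twist-unique j e-class image e′-class image′ with p^j≡1⊎p^j≡p j
  ... | inj₁ P≡1 = mod-trans (proj₁ (Class0-twist e-class image) P≡1) (mod-sym (proj₁ (Class0-twist e′-class image′) P≡1))
  ... | inj₂ P≡p = mod-trans (proj₂ (Class0-twist e-class image) P≡p) (mod-sym (proj₂ (Class0-twist e′-class image′) P≡p))

  p^R≡1+8h*d : ∀ {R} → 2 ∣ R → ∃[ d ] (p ^ R ≡ 1 + 8 * h * d)
  p^R≡1+8h*d {R} (divides r refl) with p*p≡1+8h*c
  ... | c , p*p≡1+8h*c with 1+multiple-^ (8 * h) c r
  ...   | d , [1+8hc]^r≡1+8hd = d , (begin
    p ^ (r * 2)          ≡⟨ cong (p ^_) (ℕ.*-comm r 2) ⟩
    p ^ (2 * r)          ≡⟨ ℕ.^-*-assoc p 2 r ⟨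
    (p ^ 2) ^ r          ≡⟨ cong (_^ r) (trans (cong (p *_) (ℕ.*-identityʳ p)) p*p≡1+8h*c) ⟩
    (1 + 8 * h * c) ^ r  ≡⟨ [1+8hc]^r≡1+8hd ⟩
    1 + 8 * h * d        ∎)
    where open ≡-Reasoning


  3h*b<K : ∀ (b : Fin 2) → 3 * h * Fin.toℕ b < K
  3h*b<K b = ℕ.≤-<-trans (ℕ.*-monoʳ-≤ (3 * h) (ℕ.≤-pred (Fin.toℕ<n b))) (subst (_< K) (sym (ℕ.*-identityʳ (3 * h))) 3h<K)

  3hb+Kj-Class0 : ∀ (b : Fin 2) j → Class 0 (3 * h * Fin.toℕ b + K * j)
  3hb+Kj-Class0 Fin.zero           j = inj₁ (mod-trans (mod-reflexive (cong (_+ K * j) (ℕ.*-zeroʳ (3 * h)))) (+*-mod′ 0 j))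
  3hb+Kj-Class0 (Fin.suc Fin.zero) j = inj₂ (mod-trans (mod-reflexive (cong (_+ K * j) (ℕ.*-identityʳ (3 * h)))) (+*-mod′ (3 * h) j))

  abstract
    3hb+Kj-injective : ∀ (b b′ : Fin 2) j j′ → 3 * h * Fin.toℕ b + K * j ≡ 3 * h * Fin.toℕ b′ + K * j′ → b ≡ b′ × j ≡ j′
    3hb+Kj-injective b b′ j j′ eq = b≡b′ , ℕ.*-cancelˡ-≡ j j′ K (ℕ.+-cancelˡ-≡ (3 * h * Fin.toℕ b) _ _
                                             (trans eq (cong (λ c → 3 * h * Fin.toℕ c + K * j′) (sym b≡b′))))
      where
      instance _ : NonZero (3 * h)
               _ = >-nonZero (ℕ.≤-trans h≥1 (ℕ.m≤m+n h _))
      3hb≡3hb′ : 3 * h * Fin.toℕ b ≡ 3 * h * Fin.toℕ b′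
      3hb≡3hb′ = mod-<⇒≡ (3h*b<K b) (3h*b<K b′)
        (mod-trans (mod-sym (+*-mod′ _ j)) (mod-trans (mod-reflexive eq) (+*-mod′ _ j′)))
      b≡b′ : b ≡ b′
      b≡b′ = Fin.toℕ-injective (ℕ.*-cancelˡ-≡ _ _ (3 * h) 3hb≡3hb′)

    Class0-twist-bit : ∀ {a} → Class 0 a → ∃[ b ] (a ≡ 3 * h * Fin.toℕ {2} b mod K)
    Class0-twist-bit (inj₁ a≡0)  = Fin.zero , mod-trans a≡0 (mod-reflexive (sym (ℕ.*-zeroʳ (3 * h))))
    Class0-twist-bit (inj₂ a≡3h) = Fin.suc Fin.zero , mod-trans a≡3h (mod-reflexive (sym (ℕ.*-identityʳ (3 * h))))

-- The twisted generalised Paley graph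

module TwistedPaley {p R h : ℕ} (isPrime : Prime p) (p%4≡3 : p % 4 ≡ 3) (R≥2 : 2 ≤ R) (2∣R : 2 ∣ R)
  (h≥1 : 1 ≤ h) (h%2≡1 : h % 2 ≡ 1) (2h∣p∸1 : 2 * h ∣ p ∸ 1)
  (F : Field) (enumeration : Fin (p ^ R) ↔ Field.Carrier F)
  (ω : Field.Carrier F) (ω≢0 : ω ≢ Field.0# F)
  (generates : ∀ x → x ≢ Field.0# F → ∃[ k ] (x ≡ Field._^_ F ω k)) where

  open FieldProperties F
  open FiniteField F enumeration
  open PrimitiveElement F enumeration ω ω≢0 generates
  open Frobenius isPrime (ℕ.≤-trans (s≤s z≤n) R≥2) refl
  open Exponents {p} {h} p%4≡3 h≥1 h%2≡1 2h∣p∸1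
  open TGP F p h ω
  open ≡-Reasoning

  d : ℕ
  d = proj₁ (p^R≡1+8h*d 2∣R)

  order≡8hd : order ≡ 8 * h * d
  order≡8hd = ℕ.suc-injective (trans 1+order≡q (proj₂ (p^R≡1+8h*d 2∣R)))

  d≥1 : 1 ≤ d
  d≥1 with d ℕ.≟ 0
  ... | yes d≡0 = ⊥-elim (ℕ.<⇒≱ order≥1 (ℕ.≤-reflexive (trans order≡8hd (trans (cong (8 * h *_) d≡0) (ℕ.*-zeroʳ (8 * h))))))
  ... | no  d≢0 = ℕ.n≢0⇒n>0 d≢0

  -- the number of cosets of ⟨ω^4h⟩ in the multiplicative group
  D : ℕ
  D = 2 * d

  instance
    D-nonZero : NonZero D
    D-nonZero = >-nonZero (ℕ.≤-trans d≥1 (ℕ.m≤m+n d _))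

  order≡K*D : order ≡ K * D
  order≡K*D = trans order≡8hd (regroup h d)
    where
    regroup : ∀ h d → 8 * h * d ≡ 4 * h * (2 * d)
    regroup = solve-∀

  ω^-injective-K : ∀ {a b} → ω^ a ≡ ω^ b → a ≡ b mod K
  ω^-injective-K {a} {b} eq = mod-divisor D (subst (λ M → a ≡ b mod M) order≡K*D (ω^-injective eq))

  abstract
    ω^-lift-K : ∀ {a b} → a ≡ b mod K → ∃[ t ] (ω^ (b + K * t) ≡ ω^ a)
    ω^-lift-K {a} {b} (x , y , a+xK≡b+yK) = y + x * pred D , ω^-cong (0 , x , (begin
      b + K * (y + x * pred D) + 0 * order ≡⟨ expand b K y x (pred D) ⟩
      (b + y * K) + x * pred D * K         ≡⟨ cong (_+ x * pred D * K) a+xK≡b+yK ⟨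
      (a + x * K) + x * pred D * K         ≡⟨ collect a x K (pred D) ⟩
      a + x * (K * suc (pred D))           ≡⟨ cong (λ n → a + x * (K * n)) (ℕ.suc-pred D) ⟩
      a + x * (K * D)                      ≡⟨ cong (λ n → a + x * n) order≡K*D ⟨
      a + x * order                        ∎))
      where
      expand : ∀ b K y x c → b + K * (y + x * c) + 0 ≡ (b + y * K) + x * c * K
      expand = solve-∀
      collect : ∀ a x K c → (a + x * K) + x * c * K ≡ a + x * (K * suc c)
      collect = solve-∀

  ω^Kd≡-1 : ω^ (K * d) ≡ - 1#
  ω^Kd≡-1 with ω^ (K * d) ⊕ 1# ≟ 0#
  ... | yes x+1≡0 = trans (sym (x+y-y≡x x 1#)) (trans (cong (_- 1#) x+1≡0) (+-identityˡ (- 1#)))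
    where x = ω^ (K * d)
  ... | no  x+1≢0 = ⊥-elim (order-least (K * d) Kd≥1 Kd<order x≡1)
    where
    x = ω^ (K * d)
    Kd≥1 : 1 ≤ K * d
    Kd≥1 = ℕ.*-mono-≤ {1} {K} {1} {d} (ℕ.≤-trans h≥1 (ℕ.m≤m+n h _)) d≥1
    Kd<order : K * d < order
    Kd<order = subst (K * d <_) (sym (trans order≡8hd (regroup h d))) (ℕ.m<m+n (K * d) Kd≥1)
      where
      regroup : ∀ h d → 8 * h * d ≡ 4 * h * d + 4 * h * d
      regroup = solve-∀
    x*x≡1 : x · x ≡ 1#
    x*x≡1 = trans (sym (^-+ ω (K * d) (K * d))) (trans (cong ω^_ (trans (regroup h d) (sym order≡8hd))) ω^order≡1)
      where
      regroup : ∀ h d → 4 * h * d + 4 * h * d ≡ 8 * h * d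
      regroup = solve-∀
    -- x (x + 1) = 1 + x, and x + 1 is invertible
    x≡1 : x ≡ 1#
    x≡1 = *-cancelʳ x 1# x+1≢0 (begin
      x · (x ⊕ 1#)       ≡⟨ distribˡ x x 1# ⟩
      x · x ⊕ x · 1#     ≡⟨ cong₂ _⊕_ x*x≡1 (*-identityʳ x) ⟩
      1# ⊕ x             ≡⟨ +-comm 1# x ⟩
      x ⊕ 1#             ≡⟨ *-identityˡ _ ⟨
      1# · (x ⊕ 1#)      ∎)

  abstract
    S⇒Class : ∀ {y} → S y → ∃[ a ] (y ≡ ω^ a × Class 0 a)
    S⇒Class (inj₁ (j , y≡ω^Kj)) = K * j , y≡ω^Kj , inj₁ (+*-mod′ 0 j)
    S⇒Class (inj₂ (y₀ , (j , y₀≡ω^Kj) , y≡ω^3h*y₀)) = 3 * h + K * j , (begin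
      _                        ≡⟨ y≡ω^3h*y₀ ⟩
      ω^ (3 * h) · y₀          ≡⟨ cong (ω^ (3 * h) ·_) y₀≡ω^Kj ⟩
      ω^ (3 * h) · ω^ (K * j)  ≡⟨ ^-+ ω (3 * h) (K * j) ⟨
      ω^ (3 * h + K * j)       ∎) , inj₂ (+*-mod′ (3 * h) j)

  Class⇒S : ∀ {y a} → y ≡ ω^ a → Class 0 a → S y
  Class⇒S {y} {a} y≡ω^a (inj₁ a≡0) with ω^-lift-K a≡0
  ... | t , ω^Kt≡ω^a = inj₁ (t , trans y≡ω^a (sym ω^Kt≡ω^a))
  Class⇒S {y} {a} y≡ω^a (inj₂ a≡3h) with ω^-lift-K a≡3h
  ... | t , ω^[3h+Kt]≡ω^a = inj₂ (ω^ (K * t) , (t , refl) ,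
        trans y≡ω^a (trans (sym ω^[3h+Kt]≡ω^a) (^-+ ω (3 * h) (K * t))))

  abstract
    E⇒Class : ∀ {i u v} → E i u v → ∃[ a ] (v - u ≡ ω^ a × Class (Fin.toℕ i) a)
    E⇒Class {i} (y , Sy , v-u≡ω^2i*y) with S⇒Class Sy
    ... | b , y≡ω^b , b-class = 2 * Fin.toℕ i + b ,
          trans v-u≡ω^2i*y (trans (cong (ω^ (2 * Fin.toℕ i) ·_) y≡ω^b) (sym (^-+ ω (2 * Fin.toℕ i) b))) ,
          shifted b-class
      where
      shifted : Class 0 b → Class (Fin.toℕ i) (2 * Fin.toℕ i + b)
      shifted (inj₁ b≡0)  = inj₁ (mod-trans (+-mod-congˡ (2 * Fin.toℕ i) b≡0) (mod-reflexive (ℕ.+-identityʳ _)))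
      shifted (inj₂ b≡3h) = inj₂ (+-mod-congˡ (2 * Fin.toℕ i) b≡3h)

  Class⇒E : ∀ {i u v a} → v - u ≡ ω^ a → Class (Fin.toℕ i) a → E i u v
  Class⇒E {i} {u} {v} {a} v-u≡ω^a (inj₁ a≡2i) with ω^-lift-K a≡2i
  ... | t , ω^[2i+Kt]≡ω^a = ω^ (K * t) , inj₁ (t , refl) ,
        trans v-u≡ω^a (trans (sym ω^[2i+Kt]≡ω^a) (^-+ ω (2 * Fin.toℕ i) (K * t)))
  Class⇒E {i} {u} {v} {a} v-u≡ω^a (inj₂ a≡2i+3h) with ω^-lift-K a≡2i+3h
  ... | t , ω^[2i+3h+Kt]≡ω^a = ω^ (3 * h) · ω^ (K * t) , inj₂ (ω^ (K * t) , (t , refl) , refl) , (begin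
    v - u                                         ≡⟨ v-u≡ω^a ⟩
    ω^ a                                          ≡⟨ ω^[2i+3h+Kt]≡ω^a ⟨
    ω^ (2 * Fin.toℕ i + 3 * h + K * t)            ≡⟨ ^-+ ω (2 * Fin.toℕ i + 3 * h) (K * t) ⟩
    ω^ (2 * Fin.toℕ i + 3 * h) · ω^ (K * t)       ≡⟨ cong (_· ω^ (K * t)) (^-+ ω (2 * Fin.toℕ i) (3 * h)) ⟩
    (ω^ (2 * Fin.toℕ i) · ω^ (3 * h)) · ω^ (K * t) ≡⟨ *-assoc _ _ _ ⟩
    ω^ (2 * Fin.toℕ i) · (ω^ (3 * h) · ω^ (K * t)) ∎)

  PartMap : (Carrier → Carrier) → Fin (2 * h) → Fin (2 * h) → Set
  PartMap g i j = ∀ u v → E i u v ⟺ E j (g u) (g v)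

  -- g acts on differences through φ, and φ acts on powers of ω through f
  PartMap-via-exponents : ∀ (g φ : Carrier → Carrier) (f : ℕ → ℕ) {i j} →
    (∀ u v → g v - g u ≡ φ (v - u)) → φ 0# ≡ 0# → (∀ a → φ (ω^ a) ≡ ω^ (f a)) →
    ClassMap f (Fin.toℕ i) (Fin.toℕ j) → PartMap g i j
  PartMap-via-exponents g φ f {i} {j} g-diff φ0≡0 φ-ω^ i↦j u v = to , from
    where
    to : E i u v → E j (g u) (g v)
    to Euv with E⇒Class {i} Euv
    ... | a , v-u≡ω^a , a-class =
      Class⇒E {j} (trans (g-diff u v) (trans (cong φ v-u≡ω^a) (φ-ω^ a))) (proj₁ (i↦j a) a-class)
    from : E j (g u) (g v) → E i u v
    from Eguv with E⇒Class {j} Eguv | v - u ≟ 0#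
    ... | b , gv-gu≡ω^b , _ | yes v-u≡0 =
      ⊥-elim (ω^≢0 b (trans (sym gv-gu≡ω^b) (trans (g-diff u v) (trans (cong φ v-u≡0) φ0≡0))))
    ... | b , gv-gu≡ω^b , b-class | no v-u≢0 =
      Class⇒E {i} (sym (ω^log (v - u) v-u≢0)) (proj₂ (i↦j a) (Class-resp {Fin.toℕ j} (ω^-injective-K ω^fa≡ω^b) b-class))
      where
      a = log (v - u) v-u≢0
      ω^fa≡ω^b : ω^ (f a) ≡ ω^ b
      ω^fa≡ω^b = begin
        ω^ (f a)       ≡⟨ φ-ω^ a ⟨
        φ (ω^ a)       ≡⟨ cong φ (ω^log (v - u) v-u≢0) ⟩
        φ (v - u)      ≡⟨ g-diff u v ⟨
        g v - g u      ≡⟨ gv-gu≡ω^b ⟩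
        ω^ b           ∎

  translation-PartMap : ∀ c i → PartMap (τ c) i i
  translation-PartMap c i = PartMap-via-exponents (τ c) id id {i} {i} (λ u v → +-sub-cancelʳ u v c) refl (λ _ → refl)
                              (λ _ → id , id)

  ω̂^-PartMap : ∀ k {i j} → ClassMap (_+ k) (Fin.toℕ i) (Fin.toℕ j) → PartMap (hat (ω^ k)) i j
  ω̂^-PartMap k {i} {j} = PartMap-via-exponents (hat (ω^ k)) (_· ω^ k) (_+ k) {i} {j} (λ u v → *-distribʳ-sub u v (ω^ k))
                   (zeroˡ (ω^ k)) (λ a → sym (^-+ ω a k))

  αω̂^-PartMap : ∀ {b} k {i j} → b ≡ ω^ k → ClassMap (λ a → (a + k) * p) (Fin.toℕ i) (Fin.toℕ j) →
                PartMap (α ∘ hat b) i j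
  αω̂^-PartMap {b} k {i} {j} b≡ω^k = PartMap-via-exponents (α ∘ hat b) (λ x → (x · b) ^ᶠ p) (λ a → (a + k) * p) {i} {j}
    (λ u v → trans (frobenius-sub (v · b) (u · b)) (cong (_^ᶠ p) (*-distribʳ-sub u v b)))
    (trans (cong (_^ᶠ p) (zeroˡ b)) (0^ p))
    (λ a → begin
      (ω^ a · b) ^ᶠ p       ≡⟨ cong (λ z → (ω^ a · z) ^ᶠ p) b≡ω^k ⟩
      (ω^ a · ω^ k) ^ᶠ p    ≡⟨ cong (_^ᶠ p) (^-+ ω a k) ⟨
      (ω^ (a + k)) ^ᶠ p     ≡⟨ ^-* ω (a + k) p ⟨
      ω^ ((a + k) * p)      ∎)

  G-generator-PartMap : ∀ g i → ∃[ j ] PartMap (actG g) i j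
  G-generator-PartMap (transl c) i = i , translation-PartMap c i
  G-generator-PartMap ω̂² i = part (Fin.toℕ i + 1) ,
    ω̂^-PartMap 2 {i} {part (Fin.toℕ i + 1)} (ClassMap-part {_} {Fin.toℕ i} (shift-ClassMap {Fin.toℕ i} {Fin.toℕ i + 1} 2 (mod-reflexive (double (Fin.toℕ i)))))
    where
    double : ∀ i → 2 * i + 2 ≡ 2 * (i + 1)
    double = solve-∀
  G-generator-PartMap ω̂α i = part (Fin.toℕ i + 2 + 3 * s) ,
    αω̂^-PartMap 1 {i} {part (Fin.toℕ i + 2 + 3 * s)} (sym (*-identityʳ ω)) (ClassMap-part {_} {Fin.toℕ i} (+1*p-ClassMap (Fin.toℕ i)))

  M-generator-PartMap : ∀ g i → PartMap (actM g) i i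
  M-generator-PartMap (transl c) i = translation-PartMap c i
  M-generator-PartMap ω̂⁴ʰ        i = ω̂^-PartMap K {i} {i} (+K-ClassMap (Fin.toℕ i))
  M-generator-PartMap ω̂ʰα        i = αω̂^-PartMap h {i} {i} refl (+h*p-ClassMap (Fin.toℕ i))

  PartMap-∘ : ∀ {g g′ i j k} → PartMap g i j → PartMap g′ j k → PartMap (g′ ∘ g) i k
  PartMap-∘ {g} g:i↦j g′:j↦k u v = (proj₁ (g′:j↦k _ _) ∘ proj₁ (g:i↦j u v)) , (proj₂ (g:i↦j u v) ∘ proj₂ (g′:j↦k _ _))

  PartMap-≗ : ∀ {g g′ i j} → (∀ x → g x ≡ g′ x) → PartMap g′ i j → PartMap g i j
  PartMap-≗ {j = j} g≗g′ g′:i↦j u v =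
    (λ Euv → subst₂ (E j) (sym (g≗g′ u)) (sym (g≗g′ v)) (proj₁ (g′:i↦j u v) Euv)) ,
    (λ Eguv → proj₂ (g′:i↦j u v) (subst₂ (E j) (g≗g′ u) (g≗g′ v) Eguv))

  G-word-PartMap : ∀ w i → ∃[ j ] PartMap (run actG w) i j
  G-word-PartMap []      i = i , λ u v → id , id
  G-word-PartMap (g ∷ w) i with G-generator-PartMap g i
  ... | j , g:i↦j with G-word-PartMap w j
  ...   | k , w:j↦k = k , PartMap-∘ {actG g} {run actG w} {i} {j} {k} g:i↦j w:j↦k

  M-word-PartMap : ∀ w i → PartMap (run actM w) i i
  M-word-PartMap []      i u v = id , id
  M-word-PartMap (g ∷ w) i = PartMap-∘ {actM g} {run actM w} {i} {i} {i} (M-generator-PartMap g i) (M-word-PartMap w i)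

  G-PartMap : ∀ {g} → InG g → ∀ i → ∃[ j ] PartMap g i j
  G-PartMap {g} (w , g≗w) i = proj₁ (G-word-PartMap w i) , PartMap-≗ {g} {run actG w} {i} {proj₁ (G-word-PartMap w i)} g≗w (proj₂ (G-word-PartMap w i))

  M-PartMap : ∀ {g} → InM g → ∀ i → PartMap g i i
  M-PartMap {g} (w , g≗w) i = PartMap-≗ {g} {run actM w} {i} {i} g≗w (M-word-PartMap w i)

  run-++ : ∀ {A : Set} (act : A → Carrier → Carrier) w₁ w₂ x → run act (w₁ ++ w₂) x ≡ run act w₂ (run act w₁ x)
  run-++ act w₁ w₂ x = foldl-++ (λ y g → act g y) x w₁ w₂

  run-ω̂⁴ʰ^ : ∀ t y → run actM (replicate t ω̂⁴ʰ) y ≡ y · ω^ (K * t)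
  run-ω̂⁴ʰ^ zero    y = sym (trans (cong (y ·_) (cong ω^_ (ℕ.*-zeroʳ K))) (*-identityʳ y))
  run-ω̂⁴ʰ^ (suc t) y = trans (run-ω̂⁴ʰ^ t (y · ω^ K)) (trans (*-assoc _ _ _)
    (cong (y ·_) (trans (sym (^-+ ω K (K * t))) (cong ω^_ (sym (ℕ.*-suc K t))))))

  run-ω̂²^ : ∀ n y → run actG (replicate n ω̂²) y ≡ y · ω^ (2 * n)
  run-ω̂²^ zero    y = sym (*-identityʳ y)
  run-ω̂²^ (suc n) y = trans (run-ω̂²^ n (y · ω^ 2)) (trans (*-assoc _ _ _)
    (cong (y ·_) (trans (sym (^-+ ω 2 (2 * n))) (cong ω^_ (sym (ℕ.*-suc 2 n))))))

  -- the elements of G are the maps x ↦ x^(p^j) ω^e + c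
  affine : ℕ → ℕ → Carrier → Carrier → Carrier
  affine j e c x = x ^ᶠ (p ^ j) · ω^ e ⊕ c

  IsAffine : (Carrier → Carrier) → Set
  IsAffine g = ∃[ j ] ∃[ e ] ∃[ c ] (∀ x → g x ≡ affine j e c x)

  id-affine : IsAffine id
  id-affine = 0 , 0 , 0# , λ x → sym (trans (+-identityʳ _) (trans (*-identityʳ _) (*-identityʳ x)))

  G-generator-affine : ∀ a {g} → IsAffine g → IsAffine (actG a ∘ g)
  G-generator-affine (transl c₀) (j , e , c , g≗) = j , e , c ⊕ c₀ , λ x →
    trans (cong (_⊕ c₀) (g≗ x)) (+-assoc _ _ _)
  G-generator-affine ω̂² (j , e , c , g≗) = j , e + 2 , c · ω^ 2 , λ x → begin
    _                                           ≡⟨ cong (_· ω^ 2) (g≗ x) ⟩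
    (x ^ᶠ (p ^ j) · ω^ e ⊕ c) · ω^ 2            ≡⟨ distribʳ _ _ _ ⟩
    (x ^ᶠ (p ^ j) · ω^ e) · ω^ 2 ⊕ c · ω^ 2     ≡⟨ cong (_⊕ c · ω^ 2) (*-assoc _ _ _) ⟩
    x ^ᶠ (p ^ j) · (ω^ e · ω^ 2) ⊕ c · ω^ 2     ≡⟨ cong (λ z → x ^ᶠ (p ^ j) · z ⊕ c · ω^ 2) (^-+ ω e 2) ⟨
    x ^ᶠ (p ^ j) · ω^ (e + 2) ⊕ c · ω^ 2        ∎
  G-generator-affine ω̂α (j , e , c , g≗) = suc j , (e + 1) * p , (c · ω) ^ᶠ p , λ x → begin
    _                                                  ≡⟨ cong (λ z → (z · ω) ^ᶠ p) (g≗ x) ⟩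
    ((x ^ᶠ (p ^ j) · ω^ e ⊕ c) · ω) ^ᶠ p              ≡⟨ cong (_^ᶠ p) (distribʳ _ _ _) ⟩
    ((x ^ᶠ (p ^ j) · ω^ e) · ω ⊕ c · ω) ^ᶠ p          ≡⟨ frobenius-+ _ _ ⟩
    ((x ^ᶠ (p ^ j) · ω^ e) · ω) ^ᶠ p ⊕ (c · ω) ^ᶠ p   ≡⟨ cong (λ z → z ^ᶠ p ⊕ (c · ω) ^ᶠ p) (ω^e·ω≡ω^[e+1] x) ⟩
    (x ^ᶠ (p ^ j) · ω^ (e + 1)) ^ᶠ p ⊕ (c · ω) ^ᶠ p   ≡⟨ cong (_⊕ (c · ω) ^ᶠ p) (*-^ _ _ p) ⟩
    (x ^ᶠ (p ^ j)) ^ᶠ p · (ω^ (e + 1)) ^ᶠ p ⊕ (c · ω) ^ᶠ p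
      ≡⟨ cong₂ (λ a b → a · b ⊕ (c · ω) ^ᶠ p) (^p^-comm x j) (sym (^-* ω (e + 1) p)) ⟩
    x ^ᶠ (p ^ suc j) · ω^ ((e + 1) * p) ⊕ (c · ω) ^ᶠ p ∎
    where
    ω^e·ω≡ω^[e+1] : ∀ x → (x ^ᶠ (p ^ j) · ω^ e) · ω ≡ x ^ᶠ (p ^ j) · ω^ (e + 1)
    ω^e·ω≡ω^[e+1] x = trans (*-assoc _ _ _)
      (cong (x ^ᶠ (p ^ j) ·_) (trans (cong (ω^ e ·_) (sym (*-identityʳ ω))) (sym (^-+ ω e 1))))
    ^p^-comm : ∀ x j → (x ^ᶠ (p ^ j)) ^ᶠ p ≡ x ^ᶠ (p ^ suc j)
    ^p^-comm x j = trans (sym (^-* x (p ^ j) p)) (cong (x ^ᶠ_) (ℕ.*-comm (p ^ j) p))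

  G-word-affine : ∀ w {g} → IsAffine g → IsAffine (run actG w ∘ g)
  G-word-affine []      g-affine = g-affine
  G-word-affine (a ∷ w) g-affine = G-word-affine w (G-generator-affine a g-affine)

  G-affine : ∀ {g} → InG g → IsAffine g
  G-affine {g} (w , g≗w) with G-word-affine w id-affine
  ... | j , e , c , w≗ = j , e , c , λ x → trans (g≗w x) (w≗ x)

  affine-bijective : ∀ j e c → Bijective _≡_ _≡_ (affine j e c)
  affine-bijective j e c = injective , surjective
    where
    injective : ∀ {x y} → affine j e c x ≡ affine j e c y → x ≡ y
    injective eq = ^p^-injective j (*-cancelʳ _ _ (ω^≢0 e)
      (trans (sym (x+y-y≡x _ c)) (trans (cong (_- c) eq) (x+y-y≡x _ c))))
    surjective : ∀ y → ∃[ x ] (∀ {z} → z ≡ x → affine j e c z ≡ y)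
    surjective y with inverse (ω^ e) (ω^≢0 e)
    ... | ω^-e , ω^e·ω^-e≡1 with ^p^-surjective j ((y - c) · ω^-e)
    ...   | x , x^p^j≡ = x , λ { refl → begin
      x ^ᶠ (p ^ j) · ω^ e ⊕ c           ≡⟨ cong (λ z → z · ω^ e ⊕ c) x^p^j≡ ⟩
      ((y - c) · ω^-e) · ω^ e ⊕ c       ≡⟨ cong (_⊕ c) (*-assoc _ _ _) ⟩
      (y - c) · (ω^-e · ω^ e) ⊕ c       ≡⟨ cong (λ z → (y - c) · z ⊕ c) (trans (*-comm _ _) ω^e·ω^-e≡1) ⟩
      (y - c) · 1# ⊕ c                  ≡⟨ cong (_⊕ c) (*-identityʳ _) ⟩
      (y - c) ⊕ c                       ≡⟨ x-y+y≡x y c ⟩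
      y                                 ∎ }

  G-bijective : ∀ g → InG g → Bijective _≡_ _≡_ g
  G-bijective g g∈G with G-affine g∈G
  ... | j , e , c , g≗ with affine-bijective j e c
  ...   | injective , surjective =
    (λ {x} {y} gx≡gy → injective (trans (sym (g≗ x)) (trans gx≡gy (g≗ y)))) ,
    (λ y → proj₁ (surjective y) , λ {z} z≡x → trans (g≗ z) (proj₂ (surjective y) z≡x))

  M-generator-in-G : GenM → List GenG
  M-generator-in-G (transl c) = transl c ∷ []
  M-generator-in-G ω̂⁴ʰ        = replicate (2 * h) ω̂²
  M-generator-in-G ω̂ʰα        = replicate s ω̂² ++ (ω̂α ∷ [])

  M-generator-in-G-correct : ∀ a x → actM a x ≡ run actG (M-generator-in-G a) x
  M-generator-in-G-correct (transl c) x = refl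
  M-generator-in-G-correct ω̂⁴ʰ x = trans (cong (λ k → x · ω^ k) (regroup h)) (sym (run-ω̂²^ (2 * h) x))
    where
    regroup : ∀ h → 4 * h ≡ 2 * (2 * h)
    regroup = solve-∀
  M-generator-in-G-correct ω̂ʰα x = sym (begin
    run actG (replicate s ω̂² ++ (ω̂α ∷ [])) x  ≡⟨ run-++ actG (replicate s ω̂²) _ x ⟩
    (run actG (replicate s ω̂²) x · ω) ^ᶠ p     ≡⟨ cong (λ z → (z · ω) ^ᶠ p) (run-ω̂²^ s x) ⟩
    ((x · ω^ (2 * s)) · ω) ^ᶠ p                ≡⟨ cong (_^ᶠ p) (*-assoc _ _ _) ⟩
    (x · (ω^ (2 * s) · ω)) ^ᶠ p                ≡⟨ cong (λ z → (x · (ω^ (2 * s) · z)) ^ᶠ p) (*-identityʳ ω) ⟨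
    (x · (ω^ (2 * s) · ω^ 1)) ^ᶠ p             ≡⟨ cong (λ z → (x · z) ^ᶠ p) (^-+ ω (2 * s) 1) ⟨
    (x · ω^ (2 * s + 1)) ^ᶠ p                  ≡⟨ cong (λ k → (x · ω^ k) ^ᶠ p) (trans (ℕ.+-comm (2 * s) 1) (sym h≡1+2s)) ⟩
    (x · ω^ h) ^ᶠ p                            ∎)

  M-word-in-G : List GenM → List GenG
  M-word-in-G []      = []
  M-word-in-G (a ∷ w) = M-generator-in-G a ++ M-word-in-G w

  M-word-in-G-correct : ∀ w x → run actM w x ≡ run actG (M-word-in-G w) x
  M-word-in-G-correct []      x = refl
  M-word-in-G-correct (a ∷ w) x = begin
    run actM w (actM a x)                                         ≡⟨ M-word-in-G-correct w (actM a x) ⟩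
    run actG (M-word-in-G w) (actM a x)                           ≡⟨ cong (run actG (M-word-in-G w)) (M-generator-in-G-correct a x) ⟩
    run actG (M-word-in-G w) (run actG (M-generator-in-G a) x)    ≡⟨ run-++ actG (M-generator-in-G a) (M-word-in-G w) x ⟨
    run actG (M-generator-in-G a ++ M-word-in-G w) x              ∎

  M⊆G : ∀ {g} → InM g → InG g
  M⊆G (w , g≗w) = M-word-in-G w , λ x → trans (g≗w x) (M-word-in-G-correct w x)

  ω̂ʰα^-monomial : ∀ j → ∃[ e ] (∀ x → run actM (replicate j ω̂ʰα) x ≡ x ^ᶠ (p ^ j) · ω^ e)
  ω̂ʰα^-monomial zero = 0 , λ x → sym (trans (*-identityʳ _) (*-identityʳ x))
  ω̂ʰα^-monomial (suc j) with ω̂ʰα^-monomial j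
  ... | e , w≗ = h * p * p ^ j + e , λ x → begin
    run actM (replicate j ω̂ʰα) ((x · ω^ h) ^ᶠ p)                ≡⟨ w≗ _ ⟩
    ((x · ω^ h) ^ᶠ p) ^ᶠ (p ^ j) · ω^ e                          ≡⟨ cong (_· ω^ e) (^-* (x · ω^ h) p (p ^ j)) ⟨
    (x · ω^ h) ^ᶠ (p * p ^ j) · ω^ e                             ≡⟨ cong (_· ω^ e) (*-^ x (ω^ h) (p * p ^ j)) ⟩
    (x ^ᶠ (p * p ^ j) · ω^ h ^ᶠ (p * p ^ j)) · ω^ e              ≡⟨ *-assoc _ _ _ ⟩
    x ^ᶠ (p * p ^ j) · (ω^ h ^ᶠ (p * p ^ j) · ω^ e)              ≡⟨ cong (λ z → x ^ᶠ (p * p ^ j) · (z · ω^ e)) (^-* ω h (p * p ^ j)) ⟨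
    x ^ᶠ (p * p ^ j) · (ω^ (h * (p * p ^ j)) · ω^ e)             ≡⟨ cong (x ^ᶠ (p * p ^ j) ·_) (^-+ ω (h * (p * p ^ j)) e) ⟨
    x ^ᶠ (p * p ^ j) · ω^ (h * (p * p ^ j) + e)                  ≡⟨ cong (λ k → x ^ᶠ (p * p ^ j) · ω^ (k + e)) (ℕ.*-assoc h p (p ^ j)) ⟨
    x ^ᶠ (p ^ suc j) · ω^ (h * p * p ^ j + e)                    ∎

  part₀ : Fin (2 * h)
  part₀ = Fin.fromℕ< (ℕ.≤-trans h≥1 (ℕ.m≤m+n h _))

  toℕ-part₀ : Fin.toℕ part₀ ≡ 0
  toℕ-part₀ = Fin.toℕ-fromℕ< (ℕ.≤-trans h≥1 (ℕ.m≤m+n h _))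

  Class⇒E-part₀ : ∀ {u v a} → v - u ≡ ω^ a → Class 0 a → E part₀ u v
  Class⇒E-part₀ {u} {v} {a} v-u≡ω^a a-class =
    Class⇒E {part₀} v-u≡ω^a (subst (λ i → Class i a) (sym toℕ-part₀) a-class)

  E-part₀⇒Class : ∀ {u v} → E part₀ u v → ∃[ a ] (v - u ≡ ω^ a × Class 0 a)
  E-part₀⇒Class Euv with E⇒Class {part₀} Euv
  ... | a , v-u≡ω^a , a-class = a , v-u≡ω^a , subst (λ i → Class i a) toℕ-part₀ a-class

  abstract
    affine-part₀-exponents : ∀ {g j e c} → (∀ x → g x ≡ affine j e c x) → PartMap g part₀ part₀ →
                             ∀ a → Class 0 a → Class 0 (a * p ^ j + e)
    affine-part₀-exponents {g} {j} {e} {c} g≗ g-part₀ a a-class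
      with E-part₀⇒Class (proj₁ (g-part₀ 0# (ω^ a)) (Class⇒E-part₀ (x-0≡x (ω^ a)) a-class))
    ... | b , g[ω^a]-g0≡ω^b , b-class = Class-resp {0} (ω^-injective-K (begin
      ω^ (a * p ^ j + e)                     ≡⟨ ^-+ ω (a * p ^ j) e ⟩
      ω^ (a * p ^ j) · ω^ e                  ≡⟨ cong (_· ω^ e) (^-* ω a (p ^ j)) ⟩
      (ω^ a) ^ᶠ (p ^ j) · ω^ e               ≡⟨ affine-difference (ω^ a) ⟨
      affine j e c (ω^ a) - affine j e c 0#  ≡⟨ cong₂ _-_ (g≗ (ω^ a)) (g≗ 0#) ⟨
      g (ω^ a) - g 0#                        ≡⟨ g[ω^a]-g0≡ω^b ⟩
      ω^ b                                   ∎)) b-class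
      where
      affine-difference : ∀ x → affine j e c x - affine j e c 0# ≡ x ^ᶠ (p ^ j) · ω^ e
      affine-difference x = begin
        affine j e c x - (0# ^ᶠ (p ^ j) · ω^ e ⊕ c)  ≡⟨ +-sub-cancelʳ _ _ c ⟩
        x ^ᶠ (p ^ j) · ω^ e - 0# ^ᶠ (p ^ j) · ω^ e   ≡⟨ cong (λ z → x ^ᶠ (p ^ j) · ω^ e - z · ω^ e) (0^ (p ^ j) {{ℕ.m^n≢0 p j}}) ⟩
        x ^ᶠ (p ^ j) · ω^ e - 0# · ω^ e             ≡⟨ cong (λ z → x ^ᶠ (p ^ j) · ω^ e - z) (zeroˡ _) ⟩
        x ^ᶠ (p ^ j) · ω^ e - 0#                    ≡⟨ x-0≡x _ ⟩
        x ^ᶠ (p ^ j) · ω^ e                         ∎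

    affine-twist : ∀ {f j e c} → (∀ x → f x ≡ affine j e c x) → PartMap f part₀ part₀ →
                   Class 0 e × Class 0 (3 * h * p ^ j + e)
    affine-twist {f} {j} {e} {c} f≗ f-part₀ =
      affine-part₀-exponents {f} {j} {e} {c} f≗ f-part₀ 0 (inj₁ mod-refl) ,
      affine-part₀-exponents {f} {j} {e} {c} f≗ f-part₀ (3 * h) (inj₂ mod-refl)

  -- g and the element (ω̂^h α)^j of M have the same Frobenius part and the same twist modulo 4h
  fixing-parts⇒M : ∀ {g} → InG g → (∀ i → PartMap g i i) → InM g
  fixing-parts⇒M {g} g∈G g-fixes with G-affine g∈G
  ... | j , e , c , g≗ with ω̂ʰα^-monomial j
  ...   | eM , twist≗
    with affine-twist {g} {j} {e} {c} g≗ (g-fixes part₀)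
       | affine-twist {run actM (replicate j ω̂ʰα)} {j} {eM} {0#} (λ x → trans (twist≗ x) (sym (+-identityʳ _)))
           (M-PartMap (replicate j ω̂ʰα , λ _ → refl) part₀)
  ...     | e-class , e-image | eM-class , eM-image
    with ω^-lift-K (Class0-twist-unique j {e} {eM} e-class e-image eM-class eM-image)
  ...       | t , ω^[eM+Kt]≡ω^e = word , λ x → trans (g≗ x) (sym (run-word x))
    where
    word = replicate j ω̂ʰα ++ (replicate t ω̂⁴ʰ ++ (transl c ∷ []))
    run-word : ∀ x → run actM word x ≡ affine j e c x
    run-word x = begin
      run actM word x                                         ≡⟨ run-++ actM (replicate j ω̂ʰα) _ x ⟩
      run actM (replicate t ω̂⁴ʰ ++ (transl c ∷ [])) (run actM (replicate j ω̂ʰα) x)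
                                                              ≡⟨ run-++ actM (replicate t ω̂⁴ʰ) _ _ ⟩
      run actM (replicate t ω̂⁴ʰ) (run actM (replicate j ω̂ʰα) x) ⊕ c
                                                              ≡⟨ cong (_⊕ c) (run-ω̂⁴ʰ^ t _) ⟩
      run actM (replicate j ω̂ʰα) x · ω^ (K * t) ⊕ c           ≡⟨ cong (λ z → z · ω^ (K * t) ⊕ c) (twist≗ x) ⟩
      (x ^ᶠ (p ^ j) · ω^ eM) · ω^ (K * t) ⊕ c                ≡⟨ cong (_⊕ c) (*-assoc _ _ _) ⟩
      x ^ᶠ (p ^ j) · (ω^ eM · ω^ (K * t)) ⊕ c                ≡⟨ cong (λ z → x ^ᶠ (p ^ j) · z ⊕ c) (trans (sym (^-+ ω eM (K * t))) ω^[eM+Kt]≡ω^e) ⟩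
      affine j e c x                                          ∎

  M-transitive : ∀ u v → ∃[ g ] (InM g × g u ≡ v)
  M-transitive u v = τ (v - u) , (transl (v - u) ∷ [] , λ _ → refl) , x+[y-x]≡y u v

  M-exponent-move : ∀ {a b} → a ≡ b mod K ⊎ (a + h) * p ≡ b mod K →
                    ∃[ w ] (run actM w 0# ≡ 0# × run actM w (ω^ a) ≡ ω^ b)
  M-exponent-move {a} {b} (inj₁ a≡b) with ω^-lift-K (mod-sym a≡b)
  ... | t , ω^[a+Kt]≡ω^b = replicate t ω̂⁴ʰ ,
        trans (run-ω̂⁴ʰ^ t 0#) (zeroˡ _) ,
        trans (run-ω̂⁴ʰ^ t (ω^ a)) (trans (sym (^-+ ω a (K * t))) ω^[a+Kt]≡ω^b)
  M-exponent-move {a} {b} (inj₂ [a+h]p≡b) with ω^-lift-K (mod-sym [a+h]p≡b)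
  ... | t , ω^[[a+h]p+Kt]≡ω^b = ω̂ʰα ∷ replicate t ω̂⁴ʰ ,
        trans (run-ω̂⁴ʰ^ t _) (trans (cong (λ z → z ^ᶠ p · ω^ (K * t)) (zeroˡ _))
          (trans (cong (_· ω^ (K * t)) (0^ p)) (zeroˡ _))) ,
        (begin
          run actM (replicate t ω̂⁴ʰ) ((ω^ a · ω^ h) ^ᶠ p)  ≡⟨ run-ω̂⁴ʰ^ t _ ⟩
          (ω^ a · ω^ h) ^ᶠ p · ω^ (K * t)                  ≡⟨ cong (λ z → z ^ᶠ p · ω^ (K * t)) (^-+ ω a h) ⟨
          (ω^ (a + h)) ^ᶠ p · ω^ (K * t)                   ≡⟨ cong (_· ω^ (K * t)) (^-* ω (a + h) p) ⟨
          ω^ ((a + h) * p) · ω^ (K * t)                    ≡⟨ ^-+ ω ((a + h) * p) (K * t) ⟨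
          ω^ ((a + h) * p + K * t)                         ≡⟨ ω^[[a+h]p+Kt]≡ω^b ⟩
          ω^ b                                             ∎)

  -- translate u to 0, move the exponent of v - u to that of v′ - u′, translate 0 to u′
  E-arcTransitive : ∀ i → ArcTransitive InM (E i)
  E-arcTransitive i = M-transitive , arc
    where
    arc : ∀ u v u′ v′ → E i u v → E i u′ v′ → ∃[ g ] (InM g × g u ≡ u′ × g v ≡ v′)
    arc u v u′ v′ Euv Eu′v′ with E⇒Class {i} Euv | E⇒Class {i} Eu′v′
    ... | a , v-u≡ω^a , a-class | b , v′-u′≡ω^b , b-class
      with M-exponent-move (Class-same {Fin.toℕ i} a-class b-class)
    ... | w , w0≡0 , w[ω^a]≡ω^b = run actM word , (word , λ _ → refl) ,
      (begin
        run actM word u                      ≡⟨ run-++ actM w _ (u - u) ⟩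
        run actM w (u - u) ⊕ u′              ≡⟨ cong (λ z → run actM w z ⊕ u′) (-‿inverseʳ u) ⟩
        run actM w 0# ⊕ u′                   ≡⟨ cong (_⊕ u′) w0≡0 ⟩
        0# ⊕ u′                              ≡⟨ +-identityˡ u′ ⟩
        u′                                   ∎) ,
      (begin
        run actM word v                      ≡⟨ run-++ actM w _ (v - u) ⟩
        run actM w (v - u) ⊕ u′              ≡⟨ cong (λ z → run actM w z ⊕ u′) v-u≡ω^a ⟩
        run actM w (ω^ a) ⊕ u′               ≡⟨ cong (_⊕ u′) (trans w[ω^a]≡ω^b (sym v′-u′≡ω^b)) ⟩
        (v′ - u′) ⊕ u′                       ≡⟨ x-y+y≡x v′ u′ ⟩
        v′                                   ∎)
      where
      word = transl (- u) ∷ (w ++ (transl u′ ∷ []))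

  E-irreflexive : ∀ i u v → E i u v → ¬ (u ≡ v)
  E-irreflexive i u v Euv refl with E⇒Class {i} Euv
  ... | a , u-u≡ω^a , _ = ω^≢0 a (trans (sym u-u≡ω^a) (-‿inverseʳ u))

  -- -1 = ω^(4hd) is a power of ω^(4h)
  E-symmetric : ∀ i u v → E i u v → E i v u
  E-symmetric i u v Euv with E⇒Class {i} Euv
  ... | a , v-u≡ω^a , a-class = Class⇒E {i} (begin
    u - v                   ≡⟨ -[y-x]≡x-y u v ⟨
    - (v - u)               ≡⟨ cong -_ v-u≡ω^a ⟩
    - ω^ a                  ≡⟨ cong -_ (*-identityˡ _) ⟨
    - (1# · ω^ a)           ≡⟨ -‿distribˡ-* 1# (ω^ a) ⟩
    (- 1#) · ω^ a           ≡⟨ cong (_· ω^ a) ω^Kd≡-1 ⟨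
    ω^ (K * d) · ω^ a       ≡⟨ ^-+ ω (K * d) a ⟨
    ω^ (K * d + a)          ∎) (Class-resp {Fin.toℕ i} (mod-trans (mod-reflexive (ℕ.+-comm (K * d) a)) (+*-mod′ a d)) a-class)

  E-nonempty : ∀ i → ∃[ u ] ∃[ v ] E i u v
  E-nonempty i = 0# , ω^ (2 * Fin.toℕ i) , Class⇒E {i} (x-0≡x _) (inj₁ mod-refl)

  E-cover-unique : ∀ u v → ¬ (u ≡ v) → ∃[ i ] (E i u v × (∀ j → E j u v → j ≡ i))
  E-cover-unique u v u≢v = i , Class⇒E {i} (sym (ω^log (v - u) v-u≢0)) a-class , unique
    where
    v-u≢0 : v - u ≢ 0#
    v-u≢0 v-u≡0 = u≢v (sym (x-y≡0⇒x≡y v-u≡0))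
    i = proj₁ (Class-cover (log (v - u) v-u≢0))
    a-class = proj₂ (Class-cover (log (v - u) v-u≢0))
    unique : ∀ j → E j u v → j ≡ i
    unique j Euv with E⇒Class {j} Euv
    ... | b , v-u≡ω^b , b-class = Fin.toℕ-injective (Class-unique (Fin.toℕ<n j) (Fin.toℕ<n i)
      (Class-resp {Fin.toℕ j} (ω^-injective-K (trans (ω^log (v - u) v-u≢0) v-u≡ω^b)) b-class) a-class)

  parts-transitive : ∀ i j → ∃[ g ] (InG g × PartMap g i j)
  parts-transitive i j = run actG (replicate k ω̂²) , (replicate k ω̂² , λ _ → refl) ,
    PartMap-≗ {run actG (replicate k ω̂²)} {hat (ω^ (2 * k))} {i} {j} (run-ω̂²^ k)
      (ω̂^-PartMap (2 * k) {i} {j} (shift-ClassMap {Fin.toℕ i} {Fin.toℕ j} (2 * k)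
        (mod-trans (mod-reflexive 2i+2k≡2j+K) (+-mod-modulus (2 * Fin.toℕ j)))))
    where
    k = Fin.toℕ j + (2 * h ∸ Fin.toℕ i)
    2i+2k≡2j+K : 2 * Fin.toℕ i + 2 * k ≡ 2 * Fin.toℕ j + K
    2i+2k≡2j+K = begin
      2 * Fin.toℕ i + 2 * (Fin.toℕ j + (2 * h ∸ Fin.toℕ i))  ≡⟨ swap (Fin.toℕ i) (Fin.toℕ j) (2 * h ∸ Fin.toℕ i) ⟩
      2 * Fin.toℕ j + 2 * (Fin.toℕ i + (2 * h ∸ Fin.toℕ i))  ≡⟨ cong (λ z → 2 * Fin.toℕ j + 2 * z) (ℕ.m+[n∸m]≡n (ℕ.<⇒≤ (Fin.toℕ<n i))) ⟩
      2 * Fin.toℕ j + 2 * (2 * h)                            ≡⟨ cong (2 * Fin.toℕ j +_) (sym K≡2*2h) ⟩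
      2 * Fin.toℕ j + K                                      ∎
      where
      swap : ∀ a b c → 2 * a + 2 * (b + c) ≡ 2 * b + 2 * (a + c)
      swap = solve-∀

  Γ⇒E-part₀ : ∀ u v → Γ u v → E part₀ u v
  Γ⇒E-part₀ u v Γuv = v - u , Γuv , sym (trans (cong (λ i → ω^ (2 * i) · (v - u)) toℕ-part₀) (*-identityˡ _))

  E-part₀⇒Γ : ∀ u v → E part₀ u v → Γ u v
  E-part₀⇒Γ u v (y , Sy , v-u≡ω^0*y) =
    subst S (sym (trans v-u≡ω^0*y (trans (cong (λ i → ω^ (2 * i) · y) toℕ-part₀) (*-identityˡ y)))) Sy

  Γ-undirected : Undirected Γ
  Γ-undirected u v Γuv = E-part₀⇒Γ v u (E-symmetric part₀ u v (Γ⇒E-part₀ u v Γuv))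

  Γ-arcTransitive : ArcTransitive InM Γ
  Γ-arcTransitive = proj₁ (E-arcTransitive part₀) , λ u v u′ v′ Γuv Γu′v′ →
    proj₂ (E-arcTransitive part₀) u v u′ v′ (Γ⇒E-part₀ u v Γuv) (Γ⇒E-part₀ u′ v′ Γu′v′)

  -- multiplying by ω^(order - 2i) carries ω^(2i) S onto S
  E≅Γ : ∀ i → Isomorphic (E i) Γ
  E≅Γ i = φ , (injective , surjective) , λ u v → to u v , from u v
    where
    m = order ∸ 2 * Fin.toℕ i
    2i≤order : 2 * Fin.toℕ i ≤ order
    2i≤order = ℕ.<⇒≤ (ℕ.<-≤-trans (2i<K (Fin.toℕ<n i)) (subst (K ≤_) (sym order≡K*D) (ℕ.m≤m*n K D)))
    ω^2i·ω^m≡1 : ω^ (2 * Fin.toℕ i) · ω^ m ≡ 1#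
    ω^2i·ω^m≡1 = trans (sym (^-+ ω (2 * Fin.toℕ i) m)) (trans (cong ω^_ (ℕ.m+[n∸m]≡n 2i≤order)) ω^order≡1)
    φ : Carrier → Carrier
    φ x = x · ω^ m
    φ[ω^2i·y]≡y : ∀ y → φ (ω^ (2 * Fin.toℕ i) · y) ≡ y
    φ[ω^2i·y]≡y y = trans (cong (_· ω^ m) (*-comm _ y))
      (trans (*-assoc _ _ _) (trans (cong (y ·_) ω^2i·ω^m≡1) (*-identityʳ y)))
    injective : ∀ {x y} → φ x ≡ φ y → x ≡ y
    injective {x} {y} = *-cancelʳ x y (ω^≢0 m)
    surjective : ∀ y → ∃[ x ] (∀ {z} → z ≡ x → φ z ≡ y)
    surjective y = ω^ (2 * Fin.toℕ i) · y , λ { refl → φ[ω^2i·y]≡y y }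
    to : ∀ u v → E i u v → Γ (φ u) (φ v)
    to u v (y , Sy , v-u≡ω^2i·y) =
      subst S (sym (trans (*-distribʳ-sub u v (ω^ m)) (trans (cong φ v-u≡ω^2i·y) (φ[ω^2i·y]≡y y)))) Sy
    from : ∀ u v → Γ (φ u) (φ v) → E i u v
    from u v Γφuφv = φ (v - u) , subst S (*-distribʳ-sub u v (ω^ m)) Γφuφv , sym (begin
      ω^ (2 * Fin.toℕ i) · ((v - u) · ω^ m)   ≡⟨ *-comm _ _ ⟩
      ((v - u) · ω^ m) · ω^ (2 * Fin.toℕ i)   ≡⟨ *-assoc _ _ _ ⟩
      (v - u) · (ω^ m · ω^ (2 * Fin.toℕ i))   ≡⟨ cong ((v - u) ·_) (trans (*-comm _ _) ω^2i·ω^m≡1) ⟩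
      (v - u) · 1#                            ≡⟨ *-identityʳ _ ⟩
      v - u                                   ∎)

  valency≡2D : valency p R h h≥1 ≡ 2 * D
  valency≡2D = begin
    (p ^ R ∸ 1) / (2 * h)          ≡⟨ cong (λ n → (n ∸ 1) / (2 * h)) 1+order≡q ⟨
    order / (2 * h)                ≡⟨ cong (_/ (2 * h)) (trans order≡K*D (regroup h D)) ⟩
    (2 * D * (2 * h)) / (2 * h)    ≡⟨ m*n/n≡m (2 * D) (2 * h) ⟩
    2 * D                          ∎
    where
    regroup : ∀ h D → 4 * h * D ≡ 2 * D * (2 * h)
    regroup = solve-∀

  3hb+Kj<order : ∀ (b : Fin 2) (j : Fin D) → 3 * h * Fin.toℕ b + K * Fin.toℕ j < order
  3hb+Kj<order b j = subst (3 * h * Fin.toℕ b + K * Fin.toℕ j <_) (sym order≡K*D)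
    (ℕ.<-≤-trans (ℕ.+-monoˡ-< (K * Fin.toℕ j) (3h*b<K b))
      (ℕ.≤-trans (ℕ.≤-reflexive (sym (ℕ.*-suc K (Fin.toℕ j)))) (ℕ.*-monoʳ-≤ K (Fin.toℕ<n j))))

  ω^-K*%D : ∀ c t → ω^ (c + K * (t % D)) ≡ ω^ (c + K * t)
  ω^-K*%D c t = ω^-cong (mod-sym (0 , t / D , (begin
    c + K * t + 0 * order                ≡⟨ cong (λ n → c + K * n + 0) (m≡m%n+[m/n]*n t D) ⟩
    c + K * (t % D + t / D * D) + 0      ≡⟨ regroup c K (t % D) (t / D) D ⟩
    c + K * (t % D) + t / D * (K * D)    ≡⟨ cong (λ n → c + K * (t % D) + t / D * n) order≡K*D ⟨
    c + K * (t % D) + t / D * order      ∎)))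
    where
    regroup : ∀ c K r q D → c + K * (r + q * D) + 0 ≡ c + K * r + q * (K * D)
    regroup = solve-∀

  -- the neighbours of u are u + ω^(3hb + 4hj) with b < 2 and j < D
  Γ-valency : ∀ u → HasSize (Γ u) (valency p R h h≥1)
  Γ-valency u = subst (HasSize (Γ u)) (sym valency≡2D)
    (HasSize-via *↔× neighbour adjacent injective onto)
    where
    neighbour : Fin 2 × Fin D → Carrier
    neighbour (b , j) = u ⊕ ω^ (3 * h * Fin.toℕ b + K * Fin.toℕ j)
    adjacent : ∀ bj → Γ u (neighbour bj)
    adjacent (b , j) = Class⇒S ([x+y]-x≡y u _) (3hb+Kj-Class0 b (Fin.toℕ j))
    injective : Injective _≡_ _≡_ neighbour
    injective {b , j} {b′ , j′} eq = cong₂ _,_ (proj₁ same) (Fin.toℕ-injective (proj₂ same))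
      where
      same = 3hb+Kj-injective b b′ (Fin.toℕ j) (Fin.toℕ j′)
        (ω^-injective-< (3hb+Kj<order b j) (3hb+Kj<order b′ j′)
          (trans (sym ([x+y]-x≡y u _)) (trans (cong (_- u) eq) ([x+y]-x≡y u _))))
    onto : ∀ x → Γ u x → ∃[ bj ] (neighbour bj ≡ x)
    onto x Γux with S⇒Class Γux
    ... | a , x-u≡ω^a , a-class with Class0-twist-bit a-class
    ...   | b , a≡3hb with ω^-lift-K a≡3hb
    ...     | t , ω^[3hb+Kt]≡ω^a = (b , Fin.fromℕ< (m%n<n t D)) , (begin
      u ⊕ ω^ (3 * h * Fin.toℕ b + K * Fin.toℕ (Fin.fromℕ< (m%n<n t D)))
                                         ≡⟨ cong (λ j → u ⊕ ω^ (3 * h * Fin.toℕ b + K * j)) (Fin.toℕ-fromℕ< (m%n<n t D)) ⟩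
      u ⊕ ω^ (3 * h * Fin.toℕ b + K * (t % D)) ≡⟨ cong (u ⊕_) (ω^-K*%D (3 * h * Fin.toℕ b) t) ⟩
      u ⊕ ω^ (3 * h * Fin.toℕ b + K * t) ≡⟨ cong (u ⊕_) (trans ω^[3hb+Kt]≡ω^a (sym x-u≡ω^a)) ⟩
      u ⊕ (x - u)                        ≡⟨ x+[y-x]≡y u x ⟩
      x                                  ∎)

  homogeneousFactorisation : HomogeneousFactorisation InM InG (2 * h) E
  homogeneousFactorisation = record
    { index>1            = ℕ.*-monoʳ-≤ 2 h≥1
    ; irreflexive        = E-irreflexive
    ; symmetric          = E-symmetric
    ; nonempty           = E-nonempty
    ; cover-unique       = E-cover-unique
    ; G-perm             = G-bijective
    ; G-transitive       = λ u v → map₂ (map₁ M⊆G) (M-transitive u v)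
    ; G-invariant        = λ g g∈G → G-PartMap g∈G
    ; G-parts-transitive = parts-transitive
    ; M-kernel           = λ g → (λ g∈M → M⊆G g∈M , M-PartMap g∈M) , uncurry fixing-parts⇒M
    ; M-transitive       = M-transitive
    }

proposition4p10 : (p R h : ℕ) → Prime p → p % 4 ≡ 3 →
    2 ≤ R → 2 ∣ R →
    (h≥1 : 1 ≤ h) → h % 2 ≡ 1 → (2 * h) ∣ (p ∸ 1) →
    (F : Field) → Fin (p ^ R) ↔ Field.Carrier F →
    (ω : Field.Carrier F) → ¬ (ω ≡ Field.0# F) →
    (∀ x → ¬ (x ≡ Field.0# F) → ∃[ k ] (x ≡ Field._^_ F ω k)) →
    -- (1) Γ is undirected, M-arc-transitive, of valency (p^R-1)/(2h)
    (Undirected (TGP.Γ F p h ω)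
     × ArcTransitive (TGP.InM F p h ω) (TGP.Γ F p h ω)
     × (∀ u → HasSize (TGP.Γ F p h ω u) (valency p R h h≥1)))
    -- (2) homogeneous factorisation of index 2h, M arc-transitive on each
    --     factor, and each factor isomorphic to Γ
    × (HomogeneousFactorisation (TGP.InM F p h ω) (TGP.InG F p h ω)
         (2 * h) (TGP.E F p h ω)
       × (∀ i → ArcTransitive (TGP.InM F p h ω) (TGP.E F p h ω i))
       × (∀ i → Isomorphic (TGP.E F p h ω i) (TGP.Γ F p h ω)))
proposition4p10 p R h isPrime p%4≡3 R≥2 2∣R h≥1 h%2≡1 2h∣p∸1 F enumeration ω ω≢0 generates =
  (Γ-undirected , Γ-arcTransitive , Γ-valency) , (homogeneousFactorisation , E-arcTransitive , E≅Γ)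
  where
  open TwistedPaley isPrime p%4≡3 R≥2 2∣R h≥1 h%2≡1 2h∣p∸1 F enumeration ω ω≢0 generates
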